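{- Let $D\ge2$ be squarefree, $K=\mathbb{Q}(\sqrt D)$, and let $\alpha \in \mathcal{O}_K^+$, $j\in\mathbb{Z}$, $e\in\mathbb{Z}_{\ge1}$, $f\in\mathbb{Z}_{\ge0}$ with $\alpha=e\beta_j+f\beta_{j+1}$. Then $p_K(\alpha\,|\,\mathcal{I})=2$ if and only if one of the following holds: (1) $v_j\le e\le 2v_j-1$, $0\le f\le v_{j+1}-2$, and $(e,f)\ne(2v_j-1,v_{j+1}-2)$, $(v_{j-1},e)\ne(2,2v_j-1)$, $(v_{j-1},e,f)\ne(2,2v_j-2,v_{j+1}-2)$; (2) $1\le e\le v_j-2$, $v_{j+1}\le f\le 2v_{j+1}-1$, and $(e,f)\ne(v_j-2,2v_{j+1}-1)$, $(f,v_{j+2})\ne(2v_{j+1}-1,2)$, $(e,f,v_{j+2})\ne(v_j-2,2v_{j+1}-2,2)$; (3) $e=v_j-1$, $f=v_{j+1}-1$, and $(v_{j-1},v_j,v_{j+1},v_{j+2})\ne(2,2,2,2)$.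
   Context: $\mathcal{O}_K^+$: totally positive integers of $K$; $\alpha'$ denotes the Galois conjugate. $\alpha\in\mathcal{O}_K^+$ is indecomposable if it is not a sum of two elements of $\mathcal{O}_K^+$. $p_K(\alpha\,|\,\mathcal{I})$ is the number of unordered representations $\alpha=\lambda_1+\dots+\lambda_\ell$ ($\ell\ge1$) with all $\lambda_i$ indecomposable. Notation: $\omega_D=\sqrt D$, $\xi_D=\sqrt D$ if $D\equiv2,3\pmod4$; $\omega_D=(1+\sqrt D)/2$, $\xi_D=(\sqrt D-1)/2$ if $D\equiv1\pmod4$. Write $\omega_D=[\lceil u_0/2\rceil;\overline{u_1,\dots,u_s}]$ with $u_s=u_0$ (indices extended periodically). Let $p_{ -1}=1,q_{ -1}=0$, $p_0=\lceil u_0/2\rceil$, $q_0=1$, $p_{i+2}=u_{i+2}p_{i+1}+p_i$, $q_{i+2}=u_{i+2}q_{i+1}+q_i$; put $\alpha_i=p_i+q_i\xi_D$ and $\alpha_{i,r}=\alpha_i+r\alpha_{i+1}$ (so $\alpha_{i,u_{i+2}}=\alpha_{i+2,0}$ and $\alpha_{ -1,0}=1$). The indecomposables of $\mathcal{O}_K^+$ are exactly the $\alpha_{i,r}$ with $i\ge-1$ odd, $0\le r\le u_{i+2}-1$, and their conjugates. They are ordered as a two-sided sequence $\dots<\beta_{ -1}<\beta_0=1<\beta_1<\dots$ with $\beta_{ -j}=\beta_j'$ (for $j\ge0$, $\beta_j$ runs through the $\alpha_{i,r}$ in lexicographic order of $(i,r)$). For $j\in\mathbb{Z}$ set $v_j=2$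 if $\beta_{|j|}=\alpha_{i,r}$ with $1\le r\le u_{i+2}-1$, and $v_j=u_{i+1}+2$ if $\beta_{|j|}=\alpha_{i,0}$ ($i\ge-1$ odd); then $v_j\beta_j=\beta_{j-1}+\beta_{j+1}$ for all $j$. Every $\alpha\in\mathcal{O}_K^+$ has a unique expression $\alpha=e\beta_j+f\beta_{j+1}$ with $j\in\mathbb{Z}$, $e\ge1$, $f\ge0$. -}

module Defs where

open import Data.Nat as ℕ using (ℕ; _%_)
open import Data.Nat.Divisibility using (_∣_)
open import Data.Integer as ℤ using (ℤ; +_; _+_; _-_; _*_; -_; _<_; _≤_; _>_; _≥_; 0ℤ; 1ℤ)
open import Data.Bool using (Bool; if_then_else_)
open import Data.Product using (_×_; _,_; ∃; Σ-syntax; ∃-syntax)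
open import Data.Sum using (_⊎_)
open import Data.Fin using (Fin)
open import Data.List using (List; []; _∷_; foldr)
open import Data.List.Relation.Unary.All using (All)
open import Data.List.Relation.Binary.Permutation.Propositional using (_↭_)
open import Relation.Binary.PropositionalEquality using (_≡_)
open import Relation.Nullary using (¬_)

SquareFree : ℕ → Set
SquareFree D = ∀ (m : ℕ) → (m ℕ.* m) ∣ D → m ≡ 1

-- An element of O_K, K = Q(√D), written as (a , b) meaning a + b ω_D.
OK : Set
OK = ℤ × ℤ

_⊕_ : OK → OK → OK
(a , b) ⊕ (c , d) = (a + c , b + d)

_⊖_ : OK → OK → OK
(a , b) ⊖ (c , d) = (a - c , b - d)

_·_ : ℤ → OK → OK
k · (a , b) = (k * a , k * b)

oneOK : OK
oneOK = (1ℤ , 0ℤ)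

D≡1mod4 : ℕ → Bool
D≡1mod4 D = (D % 4) ℕ.≡ᵇ 1

-- surd D α = (x , y) with α = (x + y √D) / d, where d = 2 if D ≡ 1 (mod 4)
-- (ω_D = (1+√D)/2) and d = 1 otherwise (ω_D = √D).
surd : ℕ → OK → ℤ × ℤ
surd D (a , b) = (if D≡1mod4 D then (a + a + b) else a) , b

-- PosSurd D x y : the real number x + y √D is > 0  (D not a square)
data PosSurd (D : ℕ) (x y : ℤ) : Set where
  bothNonneg : x ≥ 0ℤ → y ≥ 0ℤ → ¬ (x ≡ 0ℤ × y ≡ 0ℤ) → PosSurd D x y
  xDominates : x > 0ℤ → y < 0ℤ → (y * y) * (+ D) < x * x → PosSurd D x y
  yDominates : x < 0ℤ → y > 0ℤ → x * x < (y * y) * (+ D) → PosSurd D x y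

Positive : ℕ → OK → Set
Positive D α with surd D α
... | (x , y) = PosSurd D x y

-- α' > 0 (Galois conjugate, √D ↦ -√D)
ConjPositive : ℕ → OK → Set
ConjPositive D α with surd D α
... | (x , y) = PosSurd D x (- y)

TotPos : ℕ → OK → Set
TotPos D α = Positive D α × ConjPositive D α

_<[_]_ : OK → ℕ → OK → Set
α <[ D ] β = Positive D (β ⊖ α)

Indecomposable : ℕ → OK → Set
Indecomposable D α =
  TotPos D α × ¬ (∃[ β ] ∃[ γ ] (TotPos D β × TotPos D γ × α ≡ β ⊕ γ))

sumOK : List OK → OK
sumOK = foldr _⊕_ (0ℤ , 0ℤ)

-- A representation α = λ₁ + … + λ_ℓ (ℓ ≥ 1) with all λᵢ indecomposable
-- (as a list; unordered representations = lists up to permutation).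
IndecRep : ℕ → OK → List OK → Set
IndecRep D α L = ¬ (L ≡ []) × All (Indecomposable D) L × sumOK L ≡ α

-- p_K(α | I) = n : there are exactly n unordered representations, i.e.
-- n representations pairwise distinct up to permutation, and every
-- representation is a permutation of one of them.
PartitionCount : ℕ → OK → ℕ → Set
PartitionCount D α n =
  Σ[ R ∈ (Fin n → List OK) ]
    ((∀ i → IndecRep D α (R i))
    × (∀ i k → R i ↭ R k → i ≡ k)
    × (∀ L → IndecRep D α L → ∃[ i ] (L ↭ R i)))

IsIndecSequence : ℕ → (ℤ → OK) → Set
IsIndecSequence D β =
  (β 0ℤ ≡ oneOK)
  × (∀ j → Indecomposable D (β j))
  × (∀ j → β j <[ D ] β (j + 1ℤ))
  × (∀ α → Indecomposable D α → ∃[ j ] (β j ≡ α))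

IsVSequence : (ℤ → OK) → (ℤ → ℤ) → Set
IsVSequence β v = ∀ j → v j · β j ≡ β (j - 1ℤ) ⊕ β (j + 1ℤ)

Cond1 : (ℤ → ℤ) → ℤ → ℤ → ℤ → Set
Cond1 v j e f =
  v j ≤ e × e ≤ (+ 2) * v j - 1ℤ
  × 0ℤ ≤ f × f ≤ v (j + 1ℤ) - + 2
  × ¬ ((e , f) ≡ ((+ 2) * v j - 1ℤ , v (j + 1ℤ) - + 2))
  × ¬ ((v (j - 1ℤ) , e) ≡ (+ 2 , (+ 2) * v j - 1ℤ))
  × ¬ ((v (j - 1ℤ) , e , f) ≡ (+ 2 , (+ 2) * v j - + 2 , v (j + 1ℤ) - + 2))

Cond2 : (ℤ → ℤ) → ℤ → ℤ → ℤ → Set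
Cond2 v j e f =
  1ℤ ≤ e × e ≤ v j - + 2
  × v (j + 1ℤ) ≤ f × f ≤ (+ 2) * v (j + 1ℤ) - 1ℤ
  × ¬ ((e , f) ≡ (v j - + 2 , (+ 2) * v (j + 1ℤ) - 1ℤ))
  × ¬ ((f , v (j + + 2)) ≡ ((+ 2) * v (j + 1ℤ) - 1ℤ , + 2))
  × ¬ ((e , f , v (j + + 2)) ≡ (v j - + 2 , (+ 2) * v (j + 1ℤ) - + 2 , + 2))

Cond3 : (ℤ → ℤ) → ℤ → ℤ → ℤ → Set
Cond3 v j e f =
  e ≡ v j - 1ℤ × f ≡ v (j + 1ℤ) - 1ℤ
  × ¬ ((v (j - 1ℤ) , v j , v (j + 1ℤ) , v (j + + 2)) ≡ (+ 2 , + 2 , + 2 , + 2))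

module Submission where

-- Shifting indices we may assume j = 0, so α = e β₀ + f β₁. Put δ = det (β₀ , β₁) and, for each m,
-- φ m γ = δ · det (γ , β (m + 1) − β m). Then φ m (β m) = φ m (β (m + 1)) = δ², and since
-- β (k − 1) + β (k + 1) = v k · β k with v k ≥ 2, the sequence k ↦ φ m (β k) is convex; so φ m ≥ δ²
-- on every indecomposable, and φ m (β k) grows as k moves away from m, m + 1. Comparing φ₋₁ α and
-- φ₋₂ α with the values at β₂, β₃ shows that in each region of interest a partition of α can only use
-- β₋₂, …, β₃. Writing these in the basis β₀, β₁ through the recurrence, the partitions are then found
-- by hand: one below the corner e = v₀ − 1, f = v₁ − 1, exactly two in the regions (1)–(3), and at
-- least three elsewhere. The reflection β k ↦ β (1 − k) exchanges e and f, so left-hand exclusions and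
-- condition (2) follow from their right-hand counterparts.

open import Defs
open import Data.Bool using (true; false; if_then_else_)
open import Data.Empty using (⊥; ⊥-elim)
import Data.Fin as Fin
open import Data.List using (List; []; _∷_; _++_; replicate)
import Data.List.Properties as ListP
open import Data.List.Relation.Unary.All as All using (All; []; _∷_)
import Data.List.Relation.Unary.All.Properties as AllP
open import Data.List.Relation.Unary.Any using (here; there)
open import Data.List.Membership.Propositional using (_∈_; _∉_)
open import Data.List.Membership.Propositional.Properties using (∈-∃++)
open import Data.List.Relation.Binary.Permutation.Propositional
  using (_↭_; prep; swap; ↭-refl; ↭-sym; ↭-trans; ↭-reflexive)
import Data.List.Relation.Binary.Permutation.Propositional as Perm
open import Data.List.Relation.Binary.Permutation.Propositional.Properties
  using (shift; drop-mid; All-resp-↭; ∈-resp-↭)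
open import Data.Nat as ℕ using (ℕ; zero; suc; z≤n; s≤s)
import Data.Nat.Properties as ℕP
open import Data.Product using (∃-syntax; _×_; _,_; proj₁; proj₂)
import Data.Product as Product
open import Data.Product.Properties using (≡-dec; ,-injectiveˡ; ,-injectiveʳ)
open import Data.Product.Function.NonDependent.Propositional using (_×-⇔_)
open import Data.Sum using (_⊎_; inj₁; inj₂; [_,_]′)
open import Data.Sum.Function.Propositional using (_⊎-⇔_)
open import Function.Bundles using (_⇔_; mk⇔)
open import Function.Properties.Equivalence using (⇔-setoid) renaming (trans to ⇔-trans)
open import Function.Related.TypeIsomorphisms using (¬-cong-⇔)
open import Level using (0ℓ)
open import Relation.Binary.Definitions using (tri<; tri≈; tri>)
open import Relation.Binary.PropositionalEquality
import Relation.Binary.Reasoning.Setoid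
open import Relation.Nullary using (¬_; Dec; yes; no)

module Bounds where

  open import Data.Nat
  open import Data.Nat.Properties
  open import Data.Nat.Tactic.RingSolver using (solve-∀)

  -- tₙ (a (m + 1)) … (a (m + n − 1)) is φ m (β (m + n)) / δ² (see Functionals); the values at β m, β (m + 1) are 1.
  t₂ : ℕ → ℕ
  t₂ a = 1 + a

  t₃ : ℕ → ℕ → ℕ
  t₃ a b = (1 + b) * t₂ a + a

  t₄ : ℕ → ℕ → ℕ → ℕ
  t₄ a b c = (1 + c) * t₃ a b + b * t₂ a + a

  t₅ : ℕ → ℕ → ℕ → ℕ → ℕ
  t₅ a b c e = (1 + e) * t₄ a b c + c * t₃ a b + b * t₂ a + a

  t₂-recurrence : ∀ a → 1 + t₂ a ≡ (2 + a) * 1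
  t₂-recurrence a = identity a
    where
    identity : ∀ a → 1 + (1 + a) ≡ (2 + a) * 1
    identity = solve-∀

  t₃-recurrence : ∀ a b → 1 + t₃ a b ≡ (2 + b) * t₂ a
  t₃-recurrence a b = identity a b
    where
    identity : ∀ a b → 1 + ((1 + b) * (1 + a) + a) ≡ (2 + b) * (1 + a)
    identity = solve-∀

  t₄-recurrence : ∀ a b c → t₂ a + t₄ a b c ≡ (2 + c) * t₃ a b
  t₄-recurrence a b c = identity a b c
    where
    identity : ∀ a b c → (1 + a) + ((1 + c) * ((1 + b) * (1 + a) + a) + b * (1 + a) + a)
                       ≡ (2 + c) * ((1 + b) * (1 + a) + a)
    identity = solve-∀

  t₅-recurrence : ∀ a b c e → t₃ a b + t₅ a b c e ≡ (2 + e) * t₄ a b c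
  t₅-recurrence a b c e = identity a b c e
    where
    identity : ∀ a b c e
      → ((1 + b) * (1 + a) + a)
        + ((1 + e) * ((1 + c) * ((1 + b) * (1 + a) + a) + b * (1 + a) + a)
           + c * ((1 + b) * (1 + a) + a) + b * (1 + a) + a)
      ≡ (2 + e) * ((1 + c) * ((1 + b) * (1 + a) + a) + b * (1 + a) + a)
    identity = solve-∀

  -- With aᵢ = v (j + i) − 2: the box e < v₀, f < v₁ minus its corner, condition (1) of the theorem, and
  -- condition (3). Condition (2) is Strip a₂ a₁ a₀ f e, i.e. (1) for the reflected sequence.
  BelowCorner : ℕ → ℕ → ℕ → ℕ → Set
  BelowCorner a₀ a₁ e f = e ≤ 1 + a₀ × f ≤ 1 + a₁ × ¬ (e ≡ 1 + a₀ × f ≡ 1 + a₁)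

  Strip : ℕ → ℕ → ℕ → ℕ → ℕ → Set
  Strip a₋₁ a₀ a₁ e f =
    2 + a₀ ≤ e × e ≤ (2 + a₀) + (1 + a₀) × f ≤ a₁
    × ¬ (e ≡ (2 + a₀) + (1 + a₀) × f ≡ a₁)
    × ¬ (a₋₁ ≡ 0 × e ≡ (2 + a₀) + (1 + a₀))
    × ¬ (a₋₁ ≡ 0 × e ≡ (2 + a₀) + a₀ × f ≡ a₁)

  Corner : ℕ → ℕ → ℕ → ℕ → ℕ → ℕ → Set
  Corner a₋₁ a₀ a₁ a₂ e f = e ≡ 1 + a₀ × f ≡ 1 + a₁ × ¬ (a₋₁ ≡ 0 × a₀ ≡ 0 × a₁ ≡ 0 × a₂ ≡ 0)

  -- The bounds below majorise e and f by E and F and write T − (E x + F y) as a polynomial with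
  -- nonnegative coefficients. ≤-by-slack is opaque so that the ring-solver proofs given to it are never
  -- evaluated.
  private
    opaque
      ≤-by-slack : ∀ {T} e f E F x y slack → e ≤ E → f ≤ F → T ≡ E * x + F * y + slack → e * x + f * y ≤ T
      ≤-by-slack e f E F x y slack e≤E f≤F T≡ = ≤-trans (+-mono-≤ (*-monoˡ-≤ x e≤E) (*-monoˡ-≤ y f≤F))
        (≤-trans (m≤m+n (E * x + F * y) slack) (≤-reflexive (sym T≡)))

    ≤∧≢⇒≤pred : ∀ {m} x y → m ≤ x + suc y → ¬ m ≡ x + suc y → m ≤ x + y
    ≤∧≢⇒≤pred {m} x y m≤ m≢ = s≤s⁻¹ (subst (m <_) (+-suc x y) (≤∧≢⇒< m≤ m≢))

  BelowCorner-bound : ∀ {a₀ a₁ e f} → BelowCorner a₀ a₁ e f → e * 1 + f * t₂ a₀ ≤ t₃ a₀ a₁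
  BelowCorner-bound {a₀} {a₁} {e} {f} (e≤ , f≤ , ≢corner) with f ≟ 1 + a₁
  ... | no f≢ = ≤-by-slack e f (1 + a₀) a₁ 1 (t₂ a₀) a₀ e≤ (≤∧≢⇒≤pred 0 a₁ f≤ f≢) (identity a₀ a₁)
    where
    identity : ∀ a₀ a₁ → (1 + a₁) * (1 + a₀) + a₀ ≡ (1 + a₀) * 1 + a₁ * (1 + a₀) + a₀
    identity = solve-∀
  ... | yes f≡ = ≤-by-slack e f a₀ (1 + a₁) 1 (t₂ a₀) 0
          (≤∧≢⇒≤pred 0 a₀ e≤ (λ e≡ → ≢corner (e≡ , f≡))) f≤ (identity a₀ a₁)
    where
    identity : ∀ a₀ a₁ → (1 + a₁) * (1 + a₀) + a₀ ≡ a₀ * 1 + (1 + a₁) * (1 + a₀) + 0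
    identity = solve-∀

  Strip-bound : ∀ {a₋₁ a₀ a₁ e f} → Strip a₋₁ a₀ a₁ e f
              → e * t₂ a₋₁ + f * t₃ a₋₁ a₀ ≤ t₄ a₋₁ a₀ a₁
  Strip-bound {zero} {a₀} {a₁} {e} {f} (_ , e≤ , f≤ , _ , ≢₂ , ≢₃) with f ≟ a₁
  ... | yes f≡a₁ = ≤-by-slack e f (1 + a₀ + a₀) a₁ 1 (t₃ 0 a₀) 0 e≤′ f≤ (identity a₀ a₁)
    where
    e≤′ : e ≤ 1 + a₀ + a₀
    e≤′ = ≤∧≢⇒≤pred 0 (1 + a₀ + a₀) (≤∧≢⇒≤pred (2 + a₀) a₀ e≤ (λ e≡ → ≢₂ (refl , e≡)))
            (λ e≡ → ≢₃ (refl , e≡ , f≡a₁))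
    identity : ∀ a₀ f → (1 + f) * ((1 + a₀) * 1 + 0) + a₀ * 1 + 0
                      ≡ (1 + a₀ + a₀) * 1 + f * ((1 + a₀) * 1 + 0) + 0
    identity = solve-∀
  ... | no f≢a₁ with ≤∧≢⇒< f≤ f≢a₁
  ...   | s≤s {n = c} f≤c = ≤-by-slack e f ((2 + a₀) + a₀) c 1 (t₃ 0 a₀) a₀
            (≤∧≢⇒≤pred (2 + a₀) a₀ e≤ (λ e≡ → ≢₂ (refl , e≡))) f≤c (identity a₀ c)
    where
    identity : ∀ a₀ c → (2 + c) * ((1 + a₀) * 1 + 0) + a₀ * 1 + 0
                      ≡ ((2 + a₀) + a₀) * 1 + c * ((1 + a₀) * 1 + 0) + a₀
    identity = solve-∀
  Strip-bound {suc b} {a₀} {a₁} {e} {f} (_ , e≤ , f≤ , ≢₁ , _ , _) with f ≟ a₁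
  ... | yes f≡a₁ = ≤-by-slack e f ((2 + a₀) + a₀) a₁ (t₂ (suc b)) (t₃ (suc b) a₀) b
            (≤∧≢⇒≤pred (2 + a₀) a₀ e≤ (λ e≡ → ≢₁ (e≡ , f≡a₁))) f≤ (identity a₀ b a₁)
    where
    identity : ∀ a₀ b f → (1 + f) * ((1 + a₀) * (2 + b) + (1 + b)) + a₀ * (2 + b) + (1 + b)
                        ≡ ((2 + a₀) + a₀) * (2 + b) + f * ((1 + a₀) * (2 + b) + (1 + b)) + b
    identity = solve-∀
  ... | no f≢a₁ with ≤∧≢⇒< f≤ f≢a₁
  ...   | s≤s {n = c} f≤c = ≤-by-slack e f ((2 + a₀) + (1 + a₀)) c (t₂ (suc b)) (t₃ (suc b) a₀)
            (a₀ * (2 + b) + 1 + 2 * b) e≤ f≤c (identity a₀ b c)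
    where
    identity : ∀ a₀ b c → (2 + c) * ((1 + a₀) * (2 + b) + (1 + b)) + a₀ * (2 + b) + (1 + b)
                        ≡ ((2 + a₀) + (1 + a₀)) * (2 + b) + c * ((1 + a₀) * (2 + b) + (1 + b))
                          + (a₀ * (2 + b) + 1 + 2 * b)
    identity = solve-∀

  Strip-mirror-bound : ∀ {a₀ a₁ a₂ e f} → Strip a₂ a₁ a₀ f e → e * 1 + f * t₂ a₀ ≤ t₄ a₀ a₁ a₂
  Strip-mirror-bound {a₀} {a₁} {zero} {e} {f} (_ , f≤ , e≤ , _ , ≢₂ , ≢₃) with e ≟ a₀
  ... | yes e≡a₀ = ≤-by-slack e f a₀ (1 + a₁ + a₁) 1 (t₂ a₀) a₀ e≤ f≤′ (identity a₀ a₁)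
    where
    f≤′ : f ≤ 1 + a₁ + a₁
    f≤′ = ≤∧≢⇒≤pred 0 (1 + a₁ + a₁) (≤∧≢⇒≤pred (2 + a₁) a₁ f≤ (λ f≡ → ≢₂ (refl , f≡)))
            (λ f≡ → ≢₃ (refl , f≡ , e≡a₀))
    identity : ∀ a₀ a₁ → (1 + 0) * ((1 + a₁) * (1 + a₀) + a₀) + a₁ * (1 + a₀) + a₀
                       ≡ a₀ * 1 + (1 + a₁ + a₁) * (1 + a₀) + a₀
    identity = solve-∀
  ... | no e≢a₀ with ≤∧≢⇒< e≤ e≢a₀
  ...   | s≤s {n = c} e≤c = ≤-by-slack e f c ((2 + a₁) + a₁) 1 (t₂ (suc c)) 0
            e≤c (≤∧≢⇒≤pred (2 + a₁) a₁ f≤ (λ f≡ → ≢₂ (refl , f≡))) (identity a₁ c)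
    where
    identity : ∀ a₁ c → (1 + 0) * ((1 + a₁) * (2 + c) + (1 + c)) + a₁ * (2 + c) + (1 + c)
                      ≡ c * 1 + ((2 + a₁) + a₁) * (2 + c) + 0
    identity = solve-∀
  Strip-mirror-bound {a₀} {a₁} {suc b} {e} {f} (_ , f≤ , e≤ , ≢₁ , _ , _) with e ≟ a₀
  ... | yes e≡a₀ = ≤-by-slack e f a₀ ((2 + a₁) + a₁) 1 (t₂ a₀)
            (b * t₃ a₀ a₁ + a₁ * (1 + a₀) + 2 * a₀)
            e≤ (≤∧≢⇒≤pred (2 + a₁) a₁ f≤ (λ f≡ → ≢₁ (f≡ , e≡a₀))) (identity a₀ a₁ b)
    where
    identity : ∀ a₀ a₁ b → (2 + b) * ((1 + a₁) * (1 + a₀) + a₀) + a₁ * (1 + a₀) + a₀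
                         ≡ a₀ * 1 + ((2 + a₁) + a₁) * (1 + a₀)
                           + (b * ((1 + a₁) * (1 + a₀) + a₀) + a₁ * (1 + a₀) + 2 * a₀)
    identity = solve-∀
  ... | no e≢a₀ with ≤∧≢⇒< e≤ e≢a₀
  ...   | s≤s {n = c} e≤c = ≤-by-slack e f c ((2 + a₁) + (1 + a₁)) 1 (t₂ (suc c))
            (a₁ * (2 + c) + b * t₃ (suc c) a₁ + 1 + c)
            e≤c f≤ (identity a₁ b c)
    where
    identity : ∀ a₁ b c → (2 + b) * ((1 + a₁) * (2 + c) + (1 + c)) + a₁ * (2 + c) + (1 + c)
                        ≡ c * 1 + ((2 + a₁) + (1 + a₁)) * (2 + c)
                          + (a₁ * (2 + c) + b * ((1 + a₁) * (2 + c) + (1 + c)) + 1 + c)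
    identity = solve-∀

  Corner-bound : ∀ {a₋₁ a₀ a₁ a₂ e f} → Corner a₋₁ a₀ a₁ a₂ e f
               → e * t₂ a₋₁ + f * t₃ a₋₁ a₀ ≤ t₅ a₋₁ a₀ a₁ a₂
  Corner-bound {suc b} {a₀} {a₁} {a₂} {e} {f} (e≡ , f≡ , _) =
    ≤-by-slack e f (1 + a₀) (1 + a₁) (t₂ (suc b)) (t₃ (suc b) a₀)
      (a₁ * t₃ (suc b) a₀ + a₀ * t₂ (suc b) + a₂ * t₄ (suc b) a₀ a₁ + b)
      (≤-reflexive e≡) (≤-reflexive f≡) (identity b a₀ a₁ a₂)
    where
    identity : ∀ b a₀ a₁ a₂
      → (1 + a₂) * ((1 + a₁) * ((1 + a₀) * (2 + b) + (1 + b)) + a₀ * (2 + b) + (1 + b))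
        + a₁ * ((1 + a₀) * (2 + b) + (1 + b)) + a₀ * (2 + b) + (1 + b)
      ≡ (1 + a₀) * (2 + b) + (1 + a₁) * ((1 + a₀) * (2 + b) + (1 + b))
        + (a₁ * ((1 + a₀) * (2 + b) + (1 + b)) + a₀ * (2 + b)
           + a₂ * ((1 + a₁) * ((1 + a₀) * (2 + b) + (1 + b)) + a₀ * (2 + b) + (1 + b)) + b)
    identity = solve-∀
  Corner-bound {zero} {suc c} {a₁} {a₂} {e} {f} (e≡ , f≡ , _) =
    ≤-by-slack e f (2 + c) (1 + a₁) 1 (t₃ 0 (suc c)) (a₁ * t₃ 0 (suc c) + c + a₂ * t₄ 0 (suc c) a₁)
      (≤-reflexive e≡) (≤-reflexive f≡) (identity c a₁ a₂)
    where
    identity : ∀ c a₁ a₂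
      → (1 + a₂) * ((1 + a₁) * ((2 + c) * 1 + 0) + (1 + c) * 1 + 0)
        + a₁ * ((2 + c) * 1 + 0) + (1 + c) * 1 + 0
      ≡ (2 + c) * 1 + (1 + a₁) * ((2 + c) * 1 + 0)
        + (a₁ * ((2 + c) * 1 + 0) + c + a₂ * ((1 + a₁) * ((2 + c) * 1 + 0) + (1 + c) * 1 + 0))
    identity = solve-∀
  Corner-bound {zero} {zero} {suc c} {a₂} {e} {f} (e≡ , f≡ , _) =
    ≤-by-slack e f 1 (2 + c) 1 (t₃ 0 0) (c + a₂ * t₄ 0 0 (suc c)) (≤-reflexive e≡) (≤-reflexive f≡) (identity c a₂)
    where
    identity : ∀ c a₂
      → (1 + a₂) * ((2 + c) * (1 * 1 + 0) + 0 * 1 + 0) + (1 + c) * (1 * 1 + 0) + 0 * 1 + 0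
      ≡ 1 * 1 + (2 + c) * (1 * 1 + 0) + (c + a₂ * ((2 + c) * (1 * 1 + 0) + 0 * 1 + 0))
    identity = solve-∀
  Corner-bound {zero} {zero} {zero} {suc c} {e} {f} (e≡ , f≡ , _) =
    ≤-by-slack e f 1 1 1 (t₃ 0 0) c (≤-reflexive e≡) (≤-reflexive f≡) (identity c)
    where
    identity : ∀ c → (2 + c) * (1 * (1 * 1 + 0) + 0 * 1 + 0) + 0 * (1 * 1 + 0) + 0 * 1 + 0
                   ≡ 1 * 1 + 1 * (1 * 1 + 0) + c
    identity = solve-∀
  Corner-bound {zero} {zero} {zero} {zero} (_ , _ , not-all-zero) =
    ⊥-elim (not-all-zero (refl , refl , refl , refl))

  -- Position of e relative to v and 2 v, where v = 2 + a.
  data Zone (a : ℕ) : ℕ → Set where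
    low    : ∀ {e} → e ≤ a → Zone a e
    edge   : Zone a (1 + a)
    middle : ∀ e → e ≤ 1 + a → Zone a (2 + a + e)
    high   : ∀ e → Zone a (2 + a + (2 + a + e))

  private
    zone-beyond : ∀ a e → Zone a (2 + a + e)
    zone-beyond a e with e ≤? 1 + a
    ... | yes e≤ = middle e e≤
    ... | no e≰ with m≤n⇒∃[o]m+o≡n (≰⇒> e≰)
    ...   | w , refl = high w

  zone : ∀ a e → Zone a e
  zone a e with e ≤? a
  ... | yes e≤a = low e≤a
  ... | no e≰a with m≤n⇒∃[o]m+o≡n (≰⇒> e≰a)
  ...   | zero , refl = subst (Zone a) (cong suc (sym (+-identityʳ a))) edge
  ...   | suc w , refl = subst (Zone a) (sym (cong suc (+-suc a w))) (zone-beyond a w)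

open Bounds

open import Data.Integer as ℤ
  using (ℤ; +_; -[1+_]; 0ℤ; 1ℤ; -1ℤ; _+_; _-_; _*_; -_; _≤_; _<_; +≤+; -≤+; -≤-; +<+; ∣_∣)
import Data.Integer.Properties as ℤP
open import Data.Integer.Tactic.RingSolver using (solve-∀)
open import Algebra.Properties.AbelianGroup ℤP.+-0-abelianGroup using () renaming (∙-cancelˡ to +-cancelˡ)
open import Algebra.Properties.CommutativeSemigroup ℤP.*-commutativeSemigroup
  using () renaming (x∙yz≈y∙xz to *-swap)

det : OK → OK → ℤ
det (a , b) (c , d) = a * d - b * c

det-⊕ˡ : ∀ x y z → det (x ⊕ y) z ≡ det x z + det y z
det-⊕ˡ (a , b) (c , d) (e , f) = identity a b c d e f
  where
  identity : ∀ a b c d e f → (a + c) * f - (b + d) * e ≡ (a * f - b * e) + (c * f - d * e)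
  identity = solve-∀

det-⊕ʳ : ∀ x y z → det x (y ⊕ z) ≡ det x y + det x z
det-⊕ʳ (a , b) (c , d) (e , f) = identity a b c d e f
  where
  identity : ∀ a b c d e f → a * (d + f) - b * (c + e) ≡ (a * d - b * c) + (a * f - b * e)
  identity = solve-∀

det-·ˡ : ∀ k x y → det (k · x) y ≡ k * det x y
det-·ˡ k (a , b) (c , d) = identity k a b c d
  where
  identity : ∀ k a b c d → (k * a) * d - (k * b) * c ≡ k * (a * d - b * c)
  identity = solve-∀

det-·ʳ : ∀ k x y → det x (k · y) ≡ k * det x y
det-·ʳ k (a , b) (c , d) = identity k a b c d
  where
  identity : ∀ k a b c d → a * (k * d) - b * (k * c) ≡ k * (a * d - b * c)
  identity = solve-∀

det-⊖ʳ : ∀ x y z → det x (y ⊖ z) ≡ det x y - det x z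
det-⊖ʳ (a , b) (c , d) (e , f) = identity a b c d e f
  where
  identity : ∀ a b c d e f → a * (d - f) - b * (c - e) ≡ (a * d - b * c) - (a * f - b * e)
  identity = solve-∀

det-antisym : ∀ x y → det x y ≡ - det y x
det-antisym (a , b) (c , d) = identity a b c d
  where
  identity : ∀ a b c d → a * d - b * c ≡ - (c * b - d * a)
  identity = solve-∀

det-self : ∀ x → det x x ≡ 0ℤ
det-self (a , b) = identity a b
  where
  identity : ∀ a b → a * b - b * a ≡ 0ℤ
  identity = solve-∀

⊕-comm : ∀ x y → x ⊕ y ≡ y ⊕ x
⊕-comm (a , b) (c , d) = cong₂ _,_ (ℤP.+-comm a c) (ℤP.+-comm b d)

⊕-identityʳ : ∀ x → x ⊕ (0ℤ , 0ℤ) ≡ x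
⊕-identityʳ (a , b) = cong₂ _,_ (ℤP.+-identityʳ a) (ℤP.+-identityʳ b)

⊕-cancelˡ : ∀ x y z → x ⊕ y ≡ x ⊕ z → y ≡ z
⊕-cancelˡ (a , b) (c , d) (e , f) eq =
  cong₂ _,_ (+-cancelˡ a c e (cong proj₁ eq)) (+-cancelˡ b d f (cong proj₂ eq))

·-identityˡ : ∀ x → 1ℤ · x ≡ x
·-identityˡ (a , b) = cong₂ _,_ (ℤP.*-identityˡ a) (ℤP.*-identityˡ b)

sumOK-↭ : ∀ {L M} → L ↭ M → sumOK L ≡ sumOK M
sumOK-↭ Perm.refl = refl
sumOK-↭ (prep x p) = cong (x ⊕_) (sumOK-↭ p)
sumOK-↭ {x ∷ y ∷ L} (swap x y p) = trans (⊕-swap x y (sumOK L)) (cong (λ s → y ⊕ (x ⊕ s)) (sumOK-↭ p))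
  where
  ⊕-swap : ∀ x y z → x ⊕ (y ⊕ z) ≡ y ⊕ (x ⊕ z)
  ⊕-swap (a , b) (c , d) (e , f) = cong₂ _,_ (identity a c e) (identity b d f)
    where
    identity : ∀ a c e → a + (c + e) ≡ c + (a + e)
    identity = solve-∀
sumOK-↭ (Perm.trans p q) = trans (sumOK-↭ p) (sumOK-↭ q)

_≟_ : (x y : OK) → Dec (x ≡ y)
_≟_ = ≡-dec ℤ._≟_ ℤ._≟_

open import Data.List.Membership.DecPropositional _≟_ using (_∈?_)

module _ {D : ℕ} {α : OK} where

  partitionCount-2 : ∀ P Q → IndecRep D α P → IndecRep D α Q → ¬ (P ↭ Q)
    → (∀ L → IndecRep D α L → L ↭ P ⊎ L ↭ Q) → PartitionCount D α 2
  partitionCount-2 P Q repP repQ P≁Q complete = R , rep , injective , covering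
    where
    R : Fin.Fin 2 → List OK
    R Fin.zero = P
    R (Fin.suc _) = Q
    rep : ∀ i → IndecRep D α (R i)
    rep Fin.zero = repP
    rep (Fin.suc _) = repQ
    injective : ∀ i k → R i ↭ R k → i ≡ k
    injective Fin.zero Fin.zero _ = refl
    injective Fin.zero (Fin.suc Fin.zero) p = ⊥-elim (P≁Q p)
    injective (Fin.suc Fin.zero) Fin.zero p = ⊥-elim (P≁Q (↭-sym p))
    injective (Fin.suc Fin.zero) (Fin.suc Fin.zero) _ = refl
    covering : ∀ L → IndecRep D α L → ∃[ i ] L ↭ R i
    covering L r with complete L r
    ... | inj₁ p = Fin.zero , p
    ... | inj₂ q = Fin.suc Fin.zero , q

  unique⇒¬partitionCount-2 : ∀ P → (∀ L → IndecRep D α L → L ↭ P) → ¬ PartitionCount D α 2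
  unique⇒¬partitionCount-2 P unique (R , rep , injective , _)
    with injective Fin.zero (Fin.suc Fin.zero) (↭-trans (unique _ (rep _)) (↭-sym (unique _ (rep _))))
  ... | ()

  three⇒¬partitionCount-2 : ∀ P Q R → IndecRep D α P → IndecRep D α Q → IndecRep D α R
    → ¬ (P ↭ Q) → ¬ (P ↭ R) → ¬ (Q ↭ R) → ¬ PartitionCount D α 2
  three⇒¬partitionCount-2 P Q R repP repQ repR P≁Q P≁R Q≁R (_ , _ , _ , covering)
    with covering P repP | covering Q repQ | covering R repR
  ... | Fin.zero , p | Fin.zero , q | _ = P≁Q (↭-trans p (↭-sym q))
  ... | Fin.suc Fin.zero , p | Fin.suc Fin.zero , q | _ = P≁Q (↭-trans p (↭-sym q))
  ... | Fin.zero , p | _ | Fin.zero , r = P≁R (↭-trans p (↭-sym r))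
  ... | Fin.suc Fin.zero , p | _ | Fin.suc Fin.zero , r = P≁R (↭-trans p (↭-sym r))
  ... | _ | Fin.zero , q | Fin.zero , r = Q≁R (↭-trans q (↭-sym r))
  ... | _ | Fin.suc Fin.zero , q | Fin.suc Fin.zero , r = Q≁R (↭-trans q (↭-sym r))

∈-separates : ∀ {x : OK} {L M} → x ∈ L → x ∉ M → ¬ (L ↭ M)
∈-separates x∈L x∉M L↭M = x∉M (∈-resp-↭ L↭M x∈L)

↭-extract : ∀ {x : OK} {L} → x ∈ L → ∃[ L′ ] L ↭ x ∷ L′
↭-extract {x} x∈L with ∈-∃++ x∈L
... | ys , zs , refl = ys ++ zs , shift x ys zs

-- Chains of indecomposables

module _ (β : ℤ → OK) (w : ℤ → ℤ) (recurrence : ∀ k → w k · β k ≡ β (k - 1ℤ) ⊕ β (k + 1ℤ)) where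

  det-step : ∀ k → det (β (k - 1ℤ)) (β k) ≡ det (β k) (β (k + 1ℤ))
  det-step k = begin
    det (β (k - 1ℤ)) (β k)                                ≡⟨ det-antisym (β (k - 1ℤ)) (β k) ⟩
    - det (β k) (β (k - 1ℤ))                              ≡⟨ identity (det (β k) (β (k - 1ℤ))) (det (β k) (β (k + 1ℤ))) ⟩
    det (β k) (β (k + 1ℤ)) - (det (β k) (β (k - 1ℤ)) + det (β k) (β (k + 1ℤ)))
                                                          ≡⟨ cong (λ s → det (β k) (β (k + 1ℤ)) - s) sum≡0 ⟩
    det (β k) (β (k + 1ℤ)) - 0ℤ                           ≡⟨ ℤP.+-identityʳ _ ⟩
    det (β k) (β (k + 1ℤ))                                ∎
    where
    open ≡-Reasoning
    identity : ∀ x y → - x ≡ y - (x + y)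
    identity = solve-∀
    sum≡0 : det (β k) (β (k - 1ℤ)) + det (β k) (β (k + 1ℤ)) ≡ 0ℤ
    sum≡0 = begin
      det (β k) (β (k - 1ℤ)) + det (β k) (β (k + 1ℤ)) ≡⟨ det-⊕ʳ (β k) _ _ ⟨
      det (β k) (β (k - 1ℤ) ⊕ β (k + 1ℤ))            ≡⟨ cong (det (β k)) (recurrence k) ⟨
      det (β k) (w k · β k)                          ≡⟨ det-·ʳ (w k) (β k) (β k) ⟩
      w k * det (β k) (β k)                          ≡⟨ cong (w k *_) (det-self (β k)) ⟩
      w k * 0ℤ                                       ≡⟨ ℤP.*-zeroʳ (w k) ⟩
      0ℤ                                             ∎

  det-invariant : ∀ k → det (β k) (β (k + 1ℤ)) ≡ det (β 0ℤ) (β 1ℤ)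
  det-invariant (+ zero) = refl
  det-invariant (+ suc n) = trans (sym (det-step (+ suc n)))
    (subst (λ i → det (β (+ n)) (β i) ≡ det (β 0ℤ) (β 1ℤ)) (cong +_ (ℕP.+-comm n 1)) (det-invariant (+ n)))
  det-invariant -[1+ zero ] = det-step 0ℤ
  det-invariant -[1+ suc n ] = trans
    (subst (λ i → det (β -[1+ i ]) (β -[1+ n ]) ≡ det (β -[1+ n ]) (β (-[1+ n ] + 1ℤ)))
           (ℕP.+-identityʳ (suc n)) (det-step -[1+ n ]))
    (det-invariant -[1+ n ])

-- The paper's v k is 2 + a k; storing a k in ℕ records v k ≥ 2.
record Chain (D : ℕ) : Set where
  field
    β              : ℤ → OK
    a              : ℤ → ℕ
    recurrence     : ∀ k → (+ (2 ℕ.+ a k)) · β k ≡ β (k - 1ℤ) ⊕ β (k + 1ℤ)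
    det≢0          : ¬ det (β 0ℤ) (β 1ℤ) ≡ 0ℤ
    indecomposable : ∀ k → Indecomposable D (β k)
    exhaustive     : ∀ x → Indecomposable D x → ∃[ k ] β k ≡ x

reflect : ∀ {D} → Chain D → Chain D
reflect {D} C = record
  { β = λ k → β (1ℤ - k)
  ; a = λ k → a (1ℤ - k)
  ; recurrence = λ k → trans (recurrence (1ℤ - k))
      (trans (⊕-comm (β (1ℤ - k - 1ℤ)) (β (1ℤ - k + 1ℤ)))
             (cong₂ _⊕_ (cong β (index₁ k)) (cong β (index₂ k))))
  ; det≢0 = λ det≡0 → det≢0 (trans (det-antisym (β 0ℤ) (β 1ℤ)) (cong -_ det≡0))
  ; indecomposable = λ k → indecomposable (1ℤ - k)
  ; exhaustive = λ x x-indec → let (k , βk≡x) = exhaustive x x-indec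
                               in 1ℤ - k , trans (cong β (index₃ k)) βk≡x
  }
  where
  open Chain C
  index₁ : ∀ k → 1ℤ - k + 1ℤ ≡ 1ℤ - (k - 1ℤ)
  index₁ = solve-∀
  index₂ : ∀ k → 1ℤ - k - 1ℤ ≡ 1ℤ - (k + 1ℤ)
  index₂ = solve-∀
  index₃ : ∀ k → 1ℤ - (1ℤ - k) ≡ k
  index₃ = solve-∀

rationalPart : ℕ → OK → ℤ
rationalPart D x = proj₁ (surd D x)

rationalPart-⊕ : ∀ D x y → rationalPart D (x ⊕ y) ≡ rationalPart D x + rationalPart D y
rationalPart-⊕ D (a , b) (c , e) = by-case (D≡1mod4 D)
  where
  by-case : ∀ t → (if t then (a + c) + (a + c) + (b + e) else (a + c))
                  ≡ (if t then a + a + b else a) + (if t then c + c + e else c)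
  by-case true = identity a b c e
    where
    identity : ∀ a b c e → (a + c) + (a + c) + (b + e) ≡ (a + a + b) + (c + c + e)
    identity = solve-∀
  by-case false = refl

rationalPart-· : ∀ D k x → rationalPart D (k · x) ≡ k * rationalPart D x
rationalPart-· D k (a , b) = by-case (D≡1mod4 D)
  where
  by-case : ∀ t → (if t then k * a + k * a + k * b else k * a) ≡ k * (if t then a + a + b else a)
  by-case true = identity k a b
    where
    identity : ∀ k a b → k * a + k * a + k * b ≡ k * (a + a + b)
    identity = solve-∀
  by-case false = refl

0<rationalPart : ∀ {D} x → TotPos D x → 0ℤ < rationalPart D x
0<rationalPart {D} x (pos , conjPos) with 0ℤ ℤ.<? rationalPart D x
... | yes 0<r = 0<r
... | no 0≮r = ⊥-elim (opposite (0<surdPart pos r≤0) (0<surdPart conjPos r≤0))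
  where
  r≤0 : rationalPart D x ≤ 0ℤ
  r≤0 = ℤP.≮⇒≥ 0≮r
  0<surdPart : ∀ {r s} → PosSurd D r s → r ≤ 0ℤ → 0ℤ < s
  0<surdPart (bothNonneg 0≤r 0≤s ≢0) r≤0 with ℤP.≤-antisym r≤0 0≤r
  ... | refl = ℤP.≤∧≢⇒< 0≤s (λ 0≡s → ≢0 (refl , sym 0≡s))
  0<surdPart (xDominates 0<r _ _) r≤0 = ⊥-elim (ℤP.<-irrefl refl (ℤP.<-≤-trans 0<r r≤0))
  0<surdPart (yDominates _ 0<s _) _ = 0<s
  opposite : ∀ {s} → 0ℤ < s → ¬ 0ℤ < - s
  opposite {+ zero} (+<+ ())
  opposite {+ suc n} _ ()
  opposite { -[1+ n ]} ()

module FromHypotheses {D : ℕ} {β : ℤ → OK} {v : ℤ → ℤ}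
                      (β-seq : IsIndecSequence D β) (v-seq : IsVSequence β v) where

  private
    β₀≡1 : β 0ℤ ≡ oneOK
    β₀≡1 = proj₁ β-seq
    indecomposable : ∀ k → Indecomposable D (β k)
    indecomposable = proj₁ (proj₂ β-seq)
    increasing : ∀ k → β k <[ D ] β (k + 1ℤ)
    increasing = proj₁ (proj₂ (proj₂ β-seq))
    exhaustive : ∀ x → Indecomposable D x → ∃[ k ] β k ≡ x
    exhaustive = proj₂ (proj₂ (proj₂ β-seq))

  0<v : ∀ k → 0ℤ < v k
  0<v k = 0<*⇒0< (v k) (rationalPart D (β k)) (0<rationalPart (β k) (totPos k)) 0<v·r
    where
    totPos : ∀ k → TotPos D (β k)
    totPos k = proj₁ (indecomposable k)
    0<v·r : 0ℤ < v k * rationalPart D (β k)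
    0<v·r = subst (0ℤ <_)
      (sym (trans (sym (rationalPart-· D (v k) (β k)))
                  (trans (cong (rationalPart D) (v-seq k)) (rationalPart-⊕ D _ _))))
      (ℤP.+-mono-< (0<rationalPart _ (totPos (k - 1ℤ))) (0<rationalPart _ (totPos (k + 1ℤ))))
    0<*⇒0< : ∀ x y → 0ℤ < y → 0ℤ < x * y → 0ℤ < x
    0<*⇒0< x (+ zero) (+<+ ())
    0<*⇒0< x (+ suc n) _ = ℤP.*-cancelʳ-<-nonNeg (+ suc n)

  v≢1 : ∀ k → ¬ v k ≡ 1ℤ
  v≢1 k v≡1 = proj₂ (indecomposable k)
    ( β (k - 1ℤ) , β (k + 1ℤ) , proj₁ (indecomposable _) , proj₁ (indecomposable _)
    , trans (sym (·-identityˡ (β k))) (trans (cong (_· β k) (sym v≡1)) (v-seq k)))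

  v≡2+ : ∀ k → v k ≡ + (2 ℕ.+ (∣ v k ∣ ℕ.∸ 2))
  v≡2+ k = from-range (v k) (0<v k) (v≢1 k)
    where
    from-range : ∀ x → 0ℤ < x → ¬ x ≡ 1ℤ → x ≡ + (2 ℕ.+ (∣ x ∣ ℕ.∸ 2))
    from-range (+ 0) (+<+ ())
    from-range (+ 1) _ x≢1 = ⊥-elim (x≢1 refl)
    from-range (+ suc (suc n)) _ _ = refl

  -- If det (1 , β₁) = 0 then β₁ is a rational integer, and β₁ = 1 + (β₁ − 1) with β₁ − 1 > 0 decomposes it.
  det₀≢0 : ¬ det (β 0ℤ) (β 1ℤ) ≡ 0ℤ
  det₀≢0 det≡0 = proj₂ (indecomposable 1ℤ)
    (β 0ℤ , β 1ℤ ⊖ β 0ℤ , proj₁ (indecomposable 0ℤ) , totPos-difference , sym (⊕-⊖ (β 1ℤ) (β 0ℤ)))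
    where
    β₁-rational : β 1ℤ ≡ (proj₁ (β 1ℤ) , 0ℤ)
    β₁-rational = cong (proj₁ (β 1ℤ) ,_)
      (trans (sym (identity (proj₁ (β 1ℤ)) (proj₂ (β 1ℤ))))
             (trans (cong (λ x → det x (β 1ℤ)) (sym β₀≡1)) det≡0))
      where
      identity : ∀ c e → 1ℤ * e - 0ℤ * c ≡ e
      identity = solve-∀
    totPos-difference : TotPos D (β 1ℤ ⊖ β 0ℤ)
    totPos-difference = subst (λ x → TotPos D (x ⊖ β 0ℤ)) (sym β₁-rational)
      (subst (λ y → TotPos D ((proj₁ (β 1ℤ) , 0ℤ) ⊖ y)) (sym β₀≡1) (pos , pos))
      where
      pos : Positive D ((proj₁ (β 1ℤ) , 0ℤ) ⊖ oneOK)
      pos = subst₂ (λ x y → Positive D (x ⊖ y)) β₁-rational β₀≡1 (increasing 0ℤ)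
    ⊕-⊖ : ∀ x y → y ⊕ (x ⊖ y) ≡ x
    ⊕-⊖ (a , b) (c , e) = cong₂ _,_ (identity a c) (identity b e)
      where
      identity : ∀ a c → c + (a - c) ≡ a
      identity = solve-∀

  chainAt : ℤ → Chain D
  chainAt j = record
    { β = λ k → β (j + k)
    ; a = λ k → ∣ v (j + k) ∣ ℕ.∸ 2
    ; recurrence = λ k → trans (cong (_· β (j + k)) (sym (v≡2+ (j + k))))
        (trans (v-seq (j + k)) (cong₂ _⊕_ (cong β (ℤP.+-assoc j k -1ℤ)) (cong β (ℤP.+-assoc j k 1ℤ))))
    ; det≢0 = λ det≡0 → det₀≢0 (trans (sym (det-invariant β v v-seq j))
        (trans (cong (λ i → det (β i) (β (j + 1ℤ))) (sym (ℤP.+-identityʳ j))) det≡0))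
    ; indecomposable = λ k → indecomposable (j + k)
    ; exhaustive = λ x x-indec → let (k , βk≡x) = exhaustive x x-indec
                                 in k - j , trans (cong β (identity j k)) βk≡x
    }
    where
    identity : ∀ j k → j + (k - j) ≡ k
    identity = solve-∀

  v-chainAt : ∀ j k → v (j + k) ≡ + (2 ℕ.+ Chain.a (chainAt j) k)
  v-chainAt j k = v≡2+ (j + k)

Recurrence : (ℤ → ℕ) → (ℤ → ℤ) → Set
Recurrence a s = ∀ k → s (k - 1ℤ) + s (k + 1ℤ) ≡ + (2 ℕ.+ a k) * s k

Recurrence-mirror : ∀ {a s} → Recurrence a s → Recurrence (λ k → a (- k)) (λ k → s (- k))
Recurrence-mirror {a} {s} rec k = trans (ℤP.+-comm (s (- (k - 1ℤ))) (s (- (k + 1ℤ))))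
  (trans (cong₂ (λ i j → s i + s j) (identity₁ k) (identity₂ k)) (rec (- k)))
  where
  identity₁ : ∀ k → - (k + 1ℤ) ≡ - k - 1ℤ
  identity₁ = solve-∀
  identity₂ : ∀ k → - (k - 1ℤ) ≡ - k + 1ℤ
  identity₂ = solve-∀

module _ {a : ℤ → ℕ} {s : ℤ → ℤ} (rec : Recurrence a s) where

  Recurrence-step : ∀ k → s (k - 1ℤ) ≤ s k → 0ℤ ≤ s k → s k ≤ s (k + 1ℤ)
  Recurrence-step k s₋≤s 0≤s = subst (s k ≤_) (sym next≡)
    (subst (_≤ s k + slack) (ℤP.+-identityʳ (s k)) (ℤP.+-monoʳ-≤ (s k) 0≤slack))
    where
    slack : ℤ
    slack = (s k - s (k - 1ℤ)) + + a k * s k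
    0≤slack : 0ℤ ≤ slack
    0≤slack = ℤP.+-mono-≤ (ℤP.i≤j⇒0≤j-i s₋≤s)
      (subst (_≤ + a k * s k) (ℤP.*-zeroʳ (+ a k)) (ℤP.*-monoˡ-≤-nonNeg (+ a k) 0≤s))
    identity : ∀ x y z c → x + y ≡ (+ 2 + c) * z → y ≡ z + ((z - x) + c * z)
    identity x y z c eq = trans (solve₁ x y) (trans (cong (_- x) eq) (solve₂ x z c))
      where
      solve₁ : ∀ x y → y ≡ (x + y) - x
      solve₁ = solve-∀
      solve₂ : ∀ x z c → (+ 2 + c) * z - x ≡ z + ((z - x) + c * z)
      solve₂ = solve-∀
    next≡ : s (k + 1ℤ) ≡ s k + slack
    next≡ = identity (s (k - 1ℤ)) (s (k + 1ℤ)) (s k) (+ a k) (rec k)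

  private
    step-from : ∀ b m → s (b + + m) ≤ s (b + + suc m) → 0ℤ ≤ s (b + + suc m)
              → s (b + + suc m) ≤ s (b + + suc (suc m))
    step-from b m s≤s′ 0≤s′ = subst₂ (λ i j → s i ≤ s j) refl (identity₂ b (+ m))
      (Recurrence-step (b + + suc m) (subst (λ i → s i ≤ s (b + + suc m)) (sym (identity₁ b (+ m))) s≤s′) 0≤s′)
      where
      identity₁ : ∀ b x → b + (1ℤ + x) - 1ℤ ≡ b + x
      identity₁ = solve-∀
      identity₂ : ∀ b x → b + (1ℤ + x) + 1ℤ ≡ b + (1ℤ + (1ℤ + x))
      identity₂ = solve-∀

    climb : ∀ b → s b ≤ s (b + 1ℤ) → 0ℤ ≤ s (b + 1ℤ)
          → ∀ n → s (b + 1ℤ) ≤ s (b + + suc n) × s (b + + suc n) ≤ s (b + + suc (suc n))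
    climb b s≤s₊ 0≤s₊ zero = ℤP.≤-refl
      , step-from b 0 (subst (λ i → s i ≤ s (b + 1ℤ)) (sym (ℤP.+-identityʳ b)) s≤s₊) 0≤s₊
    climb b s≤s₊ 0≤s₊ (suc n) with climb b s≤s₊ 0≤s₊ n
    ... | s₊≤sₙ , sₙ≤sₙ₊₁ = ℤP.≤-trans s₊≤sₙ sₙ≤sₙ₊₁
      , step-from b (suc n) sₙ≤sₙ₊₁ (ℤP.≤-trans 0≤s₊ (ℤP.≤-trans s₊≤sₙ sₙ≤sₙ₊₁))

    climb-mono : ∀ b → s b ≤ s (b + 1ℤ) → 0ℤ ≤ s (b + 1ℤ)
               → ∀ m n → s (b + + suc m) ≤ s (b + + suc (m ℕ.+ n))
    climb-mono b s≤s₊ 0≤s₊ m zero = ℤP.≤-reflexive (cong (λ i → s (b + + suc i)) (sym (ℕP.+-identityʳ m)))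
    climb-mono b s≤s₊ 0≤s₊ m (suc n) = ℤP.≤-trans (climb-mono b s≤s₊ 0≤s₊ m n)
      (subst (λ i → s (b + + suc (m ℕ.+ n)) ≤ s (b + + suc i)) (sym (ℕP.+-suc m n))
             (proj₂ (climb b s≤s₊ 0≤s₊ (m ℕ.+ n))))

    offset : ∀ {i j} → i ≤ j → j ≡ i + + ∣ j - i ∣
    offset {i} {j} i≤j = trans (identity i j) (cong (λ x → i + x) (sym (ℤP.0≤i⇒+∣i∣≡i (ℤP.i≤j⇒0≤j-i i≤j))))
      where
      identity : ∀ i j → j ≡ i + (j - i)
      identity = solve-∀

  Recurrence-ascending : ∀ b → s b ≤ s (b + 1ℤ) → 0ℤ ≤ s (b + 1ℤ)
                       → ∀ {p k} → b + 1ℤ ≤ p → p ≤ k → s p ≤ s k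
  Recurrence-ascending b s≤s₊ 0≤s₊ {p} {k} b₊≤p p≤k =
    subst₂ (λ i j → s i ≤ s j) (sym p≡) (sym k≡) (climb-mono b s≤s₊ 0≤s₊ m n)
    where
    m n : ℕ
    m = ∣ p - (b + 1ℤ) ∣
    n = ∣ k - p ∣
    identity : ∀ b x → b + 1ℤ + x ≡ b + (1ℤ + x)
    identity = solve-∀
    p≡ : p ≡ b + + suc m
    p≡ = trans (offset b₊≤p) (identity b (+ m))
    k≡ : k ≡ b + + suc (m ℕ.+ n)
    k≡ = trans (offset p≤k) (trans (cong (_+ + n) p≡)
           (trans (ℤP.+-assoc b (+ suc m) (+ n)) (cong (λ x → b + x) (sym (ℤP.pos-+ (suc m) n)))))

Recurrence-descending : ∀ {a s} → Recurrence a s → ∀ b → s (b + 1ℤ) ≤ s b → 0ℤ ≤ s b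
                      → ∀ {p k} → k ≤ p → p ≤ b → s p ≤ s k
Recurrence-descending {a} {s} rec b s₊≤s 0≤s {p} {k} k≤p p≤b =
  subst₂ (λ i j → s i ≤ s j) (ℤP.neg-involutive p) (ℤP.neg-involutive k)
    (Recurrence-ascending {λ k → a (- k)} {λ k → s (- k)} (Recurrence-mirror {a} {s} rec) (- b - 1ℤ)
      (subst₂ (λ i j → s i ≤ s j) (identity₁ b) (identity₂ b) s₊≤s)
      (subst (λ i → 0ℤ ≤ s i) (identity₂ b) 0≤s)
      (subst (_≤ - p) (identity₃ b) (ℤP.neg-mono-≤ p≤b))
      (ℤP.neg-mono-≤ k≤p))
  where
  identity₁ : ∀ b → b + 1ℤ ≡ - (- b - 1ℤ)
  identity₁ = solve-∀
  identity₂ : ∀ b → b ≡ - (- b - 1ℤ + 1ℤ)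
  identity₂ = solve-∀
  identity₃ : ∀ b → - b ≡ - b - 1ℤ + 1ℤ
  identity₃ = solve-∀

Recurrence-next : ∀ {a s} → Recurrence a s → ∀ k c p q r → s (k - 1ℤ) ≡ c * + p → s k ≡ c * + q
                → p ℕ.+ r ≡ (2 ℕ.+ a k) ℕ.* q → s (k + 1ℤ) ≡ c * + r
Recurrence-next {a} {s} rec k c p q r s₋≡ s≡ p+r≡ = begin
  s (k + 1ℤ)                                  ≡⟨ identity₁ (s (k - 1ℤ)) (s (k + 1ℤ)) ⟩
  (s (k - 1ℤ) + s (k + 1ℤ)) - s (k - 1ℤ)      ≡⟨ cong (_- s (k - 1ℤ)) (rec k) ⟩
  + (2 ℕ.+ a k) * s k - s (k - 1ℤ)            ≡⟨ cong₂ (λ x y → + (2 ℕ.+ a k) * x - y) s≡ s₋≡ ⟩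
  + (2 ℕ.+ a k) * (c * + q) - c * + p         ≡⟨ identity₂ (+ (2 ℕ.+ a k)) c (+ q) (+ p) ⟩
  c * (+ (2 ℕ.+ a k) * + q) - c * + p         ≡⟨ cong (λ x → c * x - c * + p) v·q≡p+r ⟩
  c * (+ p + + r) - c * + p                   ≡⟨ identity₃ c (+ p) (+ r) ⟩
  c * + r                                     ∎
  where
  open ≡-Reasoning
  identity₁ : ∀ x y → y ≡ (x + y) - x
  identity₁ = solve-∀
  identity₂ : ∀ v c q p → v * (c * q) - c * p ≡ c * (v * q) - c * p
  identity₂ = solve-∀
  identity₃ : ∀ c p r → c * (p + r) - c * p ≡ c * r
  identity₃ = solve-∀
  v·q≡p+r : + (2 ℕ.+ a k) * + q ≡ + p + + r
  v·q≡p+r = trans (sym (ℤP.pos-* (2 ℕ.+ a k) q)) (trans (cong +_ (sym p+r≡)) (ℤP.pos-+ p r))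

-- Linear functionals on a chain

record IsLinear (F : OK → ℤ) : Set where
  field
    ⊕-homo : ∀ x y → F (x ⊕ y) ≡ F x + F y
    ·-homo : ∀ k x → F (k · x) ≡ k * F x

  zero-homo : F (0ℤ , 0ℤ) ≡ 0ℤ
  zero-homo = ·-homo 0ℤ (0ℤ , 0ℤ)

  combination-homo : ∀ x y z w → F ((x · z) ⊕ (y · w)) ≡ x * F z + y * F w
  combination-homo x y z w = trans (⊕-homo _ _) (cong₂ _+_ (·-homo x z) (·-homo y w))

module Functionals {D : ℕ} (C : Chain D) where

  open Chain C public

  δ : ℤ
  δ = det (β 0ℤ) (β 1ℤ)

  det-consecutive : ∀ m → det (β m) (β (m + 1ℤ)) ≡ δ
  det-consecutive = det-invariant β (λ k → + (2 ℕ.+ a k)) recurrence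

  d : ℤ
  d = δ * δ

  0<d : 0ℤ < d
  0<d = 0<square δ det≢0
    where
    0<square : ∀ x → ¬ x ≡ 0ℤ → 0ℤ < x * x
    0<square (+ zero) x≢0 = ⊥-elim (x≢0 refl)
    0<square (+ suc n) _ = +<+ (s≤s z≤n)
    0<square -[1+ n ] _ = +<+ (s≤s z≤n)

  -- Scaling by δ makes the values at β m and β (m + 1) equal to δ² > 0 whatever the orientation of β₀, β₁.
  φ : ℤ → OK → ℤ
  φ m γ = δ * det γ (β (m + 1ℤ) ⊖ β m)

  -- ψ m is ≥ δ² on β k for k > m and ≤ −δ² for k < m; it separates the β k and the coordinates along β₀, β₁.
  ψ : ℤ → OK → ℤ
  ψ m γ = δ * det (β m) γ

  φ-linear : ∀ m → IsLinear (φ m)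
  φ-linear m = record
    { ⊕-homo = λ x y → trans (cong (δ *_) (det-⊕ˡ x y _)) (ℤP.*-distribˡ-+ δ _ _)
    ; ·-homo = λ k x → trans (cong (δ *_) (det-·ˡ k x _)) (*-swap δ k _)
    }

  ψ-linear : ∀ m → IsLinear (ψ m)
  ψ-linear m = record
    { ⊕-homo = λ x y → trans (cong (δ *_) (det-⊕ʳ (β m) x y)) (ℤP.*-distribˡ-+ δ _ _)
    ; ·-homo = λ k x → trans (cong (δ *_) (det-·ʳ k (β m) x)) (*-swap δ k _)
    }

  Recurrence-linear : ∀ {F} → IsLinear F → Recurrence a (λ k → F (β k))
  Recurrence-linear {F} F-linear k = begin
    F (β (k - 1ℤ)) + F (β (k + 1ℤ))   ≡⟨ ⊕-homo _ _ ⟨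
    F (β (k - 1ℤ) ⊕ β (k + 1ℤ))       ≡⟨ cong F (recurrence k) ⟨
    F ((+ (2 ℕ.+ a k)) · β k)         ≡⟨ ·-homo (+ (2 ℕ.+ a k)) (β k) ⟩
    + (2 ℕ.+ a k) * F (β k)           ∎
    where
    open ≡-Reasoning
    open IsLinear F-linear

  φ-at-m : ∀ m → φ m (β m) ≡ d
  φ-at-m m = cong (δ *_) (begin
    det (β m) (β (m + 1ℤ) ⊖ β m)               ≡⟨ det-⊖ʳ (β m) (β (m + 1ℤ)) (β m) ⟩
    det (β m) (β (m + 1ℤ)) - det (β m) (β m)   ≡⟨ cong₂ _-_ (det-consecutive m) (det-self (β m)) ⟩
    δ - 0ℤ                                     ≡⟨ ℤP.+-identityʳ δ ⟩
    δ                                          ∎)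
    where open ≡-Reasoning

  φ-at-m+1 : ∀ m → φ m (β (m + 1ℤ)) ≡ d
  φ-at-m+1 m = cong (δ *_) (begin
    det (β (m + 1ℤ)) (β (m + 1ℤ) ⊖ β m)                  ≡⟨ det-⊖ʳ (β (m + 1ℤ)) (β (m + 1ℤ)) (β m) ⟩
    det (β (m + 1ℤ)) (β (m + 1ℤ)) - det (β (m + 1ℤ)) (β m)
                                                         ≡⟨ cong₂ _-_ (det-self (β (m + 1ℤ))) (det-antisym (β (m + 1ℤ)) (β m)) ⟩
    0ℤ - - det (β m) (β (m + 1ℤ))                        ≡⟨ cong (λ x → 0ℤ - - x) (det-consecutive m) ⟩
    0ℤ - - δ                                             ≡⟨ ℤP.+-identityˡ (- - δ) ⟩
    - - δ                                                ≡⟨ ℤP.neg-involutive δ ⟩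
    δ                                                    ∎)
    where open ≡-Reasoning

  ψ-at-m : ∀ m → ψ m (β m) ≡ 0ℤ
  ψ-at-m m = trans (cong (δ *_) (det-self (β m))) (ℤP.*-zeroʳ δ)

  ψ-at-m+1 : ∀ m → ψ m (β (m + 1ℤ)) ≡ d
  ψ-at-m+1 m = cong (δ *_) (det-consecutive m)

  ψ-at-m-1 : ∀ m → ψ m (β (m - 1ℤ)) ≡ - d
  ψ-at-m-1 m = begin
    δ * det (β m) (β (m - 1ℤ))       ≡⟨ cong (δ *_) (det-antisym (β m) (β (m - 1ℤ))) ⟩
    δ * - det (β (m - 1ℤ)) (β m)     ≡⟨ cong (λ i → δ * - det (β (m - 1ℤ)) (β i)) (identity m) ⟩
    δ * - det (β (m - 1ℤ)) (β (m - 1ℤ + 1ℤ)) ≡⟨ cong (λ x → δ * - x) (det-consecutive (m - 1ℤ)) ⟩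
    δ * - δ                          ≡⟨ ℤP.neg-distribʳ-* δ δ ⟨
    - d                              ∎
    where
    open ≡-Reasoning
    identity : ∀ m → m ≡ m - 1ℤ + 1ℤ
    identity = solve-∀

  φ-ascending : ∀ m {p k} → m + 1ℤ ≤ p → p ≤ k → φ m (β p) ≤ φ m (β k)
  φ-ascending m = Recurrence-ascending {a = a} {s = λ k → φ m (β k)} (Recurrence-linear (φ-linear m)) m
    (ℤP.≤-reflexive (trans (φ-at-m m) (sym (φ-at-m+1 m))))
    (subst (0ℤ ≤_) (sym (φ-at-m+1 m)) (ℤP.<⇒≤ 0<d))

  d≤φ : ∀ m k → d ≤ φ m (β k)
  d≤φ m k with m ℤ.<? k
  ... | yes m<k = subst (_≤ φ m (β k)) (φ-at-m+1 m)
    (φ-ascending m ℤP.≤-refl (subst (_≤ k) (ℤP.+-comm 1ℤ m) (ℤP.i<j⇒suc[i]≤j m<k)))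
  ... | no m≮k = subst (_≤ φ m (β k)) (φ-at-m m)
    (Recurrence-descending {a = a} {s = λ k → φ m (β k)} (Recurrence-linear (φ-linear m)) m
      (ℤP.≤-reflexive (trans (φ-at-m+1 m) (sym (φ-at-m m))))
      (subst (0ℤ ≤_) (sym (φ-at-m m)) (ℤP.<⇒≤ 0<d))
      (ℤP.≮⇒≥ m≮k) ℤP.≤-refl)

  d≤ψ : ∀ m {k} → m + 1ℤ ≤ k → d ≤ ψ m (β k)
  d≤ψ m {k} m+1≤k = subst (_≤ ψ m (β k)) (ψ-at-m+1 m)
    (Recurrence-ascending {a = a} {s = λ k → ψ m (β k)} (Recurrence-linear (ψ-linear m)) m
      (subst₂ _≤_ (sym (ψ-at-m m)) (sym (ψ-at-m+1 m)) (ℤP.<⇒≤ 0<d))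
      (subst (0ℤ ≤_) (sym (ψ-at-m+1 m)) (ℤP.<⇒≤ 0<d))
      ℤP.≤-refl m+1≤k)

  d≤-ψ : ∀ m {k} → k ≤ m - 1ℤ → d ≤ - ψ m (β k)
  d≤-ψ m {k} k≤m-1 = subst (_≤ - ψ m (β k)) -ψ-at-m-1
    (Recurrence-descending {a = a} {s = λ k → - ψ m (β k)} -ψ-recurrence (m - 1ℤ)
      (subst₂ _≤_ (sym -ψ-at-m) (sym -ψ-at-m-1) (ℤP.<⇒≤ 0<d))
      (subst (0ℤ ≤_) (sym -ψ-at-m-1) (ℤP.<⇒≤ 0<d))
      k≤m-1 ℤP.≤-refl)
    where
    -ψ-recurrence : Recurrence a (λ k → - ψ m (β k))
    -ψ-recurrence = Recurrence-linear -ψ-linear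
      where
      -ψ-linear : IsLinear (λ x → - ψ m x)
      -ψ-linear = record
        { ⊕-homo = λ x y → trans (cong -_ (IsLinear.⊕-homo (ψ-linear m) x y)) (ℤP.neg-distrib-+ (ψ m x) (ψ m y))
        ; ·-homo = λ k x → trans (cong -_ (IsLinear.·-homo (ψ-linear m) k x)) (ℤP.neg-distribʳ-* k _)
        }
    -ψ-at-m-1 : - ψ m (β (m - 1ℤ)) ≡ d
    -ψ-at-m-1 = trans (cong -_ (ψ-at-m-1 m)) (ℤP.neg-involutive d)
    -ψ-at-m : - ψ m (β (m - 1ℤ + 1ℤ)) ≡ 0ℤ
    -ψ-at-m = cong -_ (trans (cong (λ i → ψ m (β i)) (identity m)) (ψ-at-m m))
      where
      identity : ∀ m → m - 1ℤ + 1ℤ ≡ m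
      identity = solve-∀

  β-injective : ∀ {k k′} → β k ≡ β k′ → k ≡ k′
  β-injective {k} {k′} βk≡βk′ with ℤP.<-cmp k k′
  ... | tri≈ _ k≡k′ _ = k≡k′
  ... | tri< k<k′ _ _ = ⊥-elim (ℤP.<-irrefl refl (ℤP.<-≤-trans 0<d
          (subst (d ≤_) (trans (cong (ψ k) (sym βk≡βk′)) (ψ-at-m k))
                 (d≤ψ k (subst (_≤ k′) (ℤP.+-comm 1ℤ k) (ℤP.i<j⇒suc[i]≤j k<k′))))))
  ... | tri> _ _ k′<k = ⊥-elim (ℤP.<-irrefl refl (ℤP.<-≤-trans 0<d
          (subst (d ≤_) (trans (cong (λ x → - ψ k x) (sym βk≡βk′)) (cong -_ (ψ-at-m k)))
                 (d≤-ψ k (subst (k′ ≤_) (ℤP.+-comm -1ℤ k) (ℤP.i<j⇒i≤pred[j] k′<k))))))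

-- Parts far from β₀, β₁

module Exclusion {D : ℕ} (C : Chain D) where

  open Functionals C public

  α : ℕ → ℕ → OK
  α e f = ((+ e) · β 0ℤ) ⊕ ((+ f) · β 1ℤ)

  a₋₁ a₀ a₁ a₂ : ℕ
  a₋₁ = a -1ℤ
  a₀ = a 0ℤ
  a₁ = a 1ℤ
  a₂ = a (+ 2)

  ψ₀-α : ∀ e f → ψ 0ℤ (α e f) ≡ + f * d
  ψ₀-α e f = begin
    ψ 0ℤ (α e f)                            ≡⟨ IsLinear.combination-homo (ψ-linear 0ℤ) (+ e) (+ f) (β 0ℤ) (β 1ℤ) ⟩
    + e * ψ 0ℤ (β 0ℤ) + + f * ψ 0ℤ (β 1ℤ)   ≡⟨ cong₂ (λ x y → + e * x + + f * y) (ψ-at-m 0ℤ) (ψ-at-m+1 0ℤ) ⟩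
    + e * 0ℤ + + f * d                      ≡⟨ identity (+ e) (+ f) d ⟩
    + f * d                                 ∎
    where
    open ≡-Reasoning
    identity : ∀ e f d → e * 0ℤ + f * d ≡ f * d
    identity = solve-∀

  ψ₁-α : ∀ e f → ψ 1ℤ (α e f) ≡ - (+ e * d)
  ψ₁-α e f = begin
    ψ 1ℤ (α e f)                            ≡⟨ IsLinear.combination-homo (ψ-linear 1ℤ) (+ e) (+ f) (β 0ℤ) (β 1ℤ) ⟩
    + e * ψ 1ℤ (β 0ℤ) + + f * ψ 1ℤ (β 1ℤ)   ≡⟨ cong₂ (λ x y → + e * x + + f * y) (ψ-at-m-1 1ℤ) (ψ-at-m 1ℤ) ⟩
    + e * - d + + f * 0ℤ                    ≡⟨ identity (+ e) (+ f) d ⟩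
    - (+ e * d)                             ∎
    where
    open ≡-Reasoning
    identity : ∀ e f d → e * - d + f * 0ℤ ≡ - (e * d)
    identity = solve-∀

  α-injective : ∀ {e f e′ f′} → α e f ≡ α e′ f′ → e ≡ e′ × f ≡ f′
  α-injective {e} {f} {e′} {f′} α≡α′ =
      ℤP.+-injective (cancel (ℤP.neg-injective (trans (sym (ψ₁-α e f)) (trans (cong (ψ 1ℤ) α≡α′) (ψ₁-α e′ f′)))))
    , ℤP.+-injective (cancel (trans (sym (ψ₀-α e f)) (trans (cong (ψ 0ℤ) α≡α′) (ψ₀-α e′ f′))))
    where
    cancel : ∀ {x y} → x * d ≡ y * d → x ≡ y
    cancel {x} {y} = ℤP.*-cancelʳ-≡ x y d {{ℤ.>-nonZero 0<d}}

  β≢0 : ∀ k → ¬ β k ≡ (0ℤ , 0ℤ)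
  β≢0 k βk≡0 = ℤP.<-irrefl refl (ℤP.<-≤-trans 0<d
    (subst (d ≤_) (trans (cong (φ 0ℤ) βk≡0) (IsLinear.zero-homo (φ-linear 0ℤ))) (d≤φ 0ℤ k)))

  d≤φ-indecomposable : ∀ m {x} → Indecomposable D x → d ≤ φ m x
  d≤φ-indecomposable m {x} x-indec with exhaustive x x-indec
  ... | k , refl = d≤φ m k

  0≤φ-sum : ∀ m {L} → All (Indecomposable D) L → 0ℤ ≤ φ m (sumOK L)
  0≤φ-sum m [] = ℤP.≤-reflexive (sym (IsLinear.zero-homo (φ-linear m)))
  0≤φ-sum m {x ∷ L} (x-indec ∷ L-indec) = subst (0ℤ ≤_) (sym (IsLinear.⊕-homo (φ-linear m) x (sumOK L)))
    (ℤP.+-mono-≤ (ℤP.<⇒≤ (ℤP.<-≤-trans 0<d (d≤φ-indecomposable m x-indec))) (0≤φ-sum m L-indec))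

  d+φ≤φ-∷ : ∀ m {x L} → All (Indecomposable D) (x ∷ L) → d + φ m (sumOK L) ≤ φ m (sumOK (x ∷ L))
  d+φ≤φ-∷ m {x} {L} (x-indec ∷ _) = subst (d + φ m (sumOK L) ≤_) (sym (IsLinear.⊕-homo (φ-linear m) x (sumOK L)))
    (ℤP.+-monoˡ-≤ (φ m (sumOK L)) (d≤φ-indecomposable m x-indec))

  d≤φ-sum : ∀ m {x L} → All (Indecomposable D) (x ∷ L) → d ≤ φ m (sumOK (x ∷ L))
  d≤φ-sum m {L = L} all@(_ ∷ L-indec) = ℤP.≤-trans (ℤP.≤-trans (ℤP.≤-reflexive (sym (ℤP.+-identityʳ d)))
    (ℤP.+-monoʳ-≤ d (0≤φ-sum m L-indec))) (d+φ≤φ-∷ m all)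

  <+d : ∀ x → x < x + d
  <+d x = subst (_< x + d) (ℤP.+-identityʳ x) (ℤP.+-monoʳ-< x 0<d)

  partition-of-β : ∀ m {L} → IndecRep D (β m) L → L ↭ β m ∷ []
  partition-of-β m {[]} (L≢[] , _) = ⊥-elim (L≢[] refl)
  partition-of-β m {x ∷ []} (_ , _ , sum≡) = ↭-reflexive (cong (_∷ []) (trans (sym (⊕-identityʳ x)) sum≡))
  partition-of-β m {x ∷ y ∷ L} (_ , indec@(_ ∷ rest) , sum≡) = ⊥-elim (ℤP.<-irrefl refl (begin-strict
    d                         <⟨ <+d d ⟩
    d + d                     ≤⟨ ℤP.+-monoʳ-≤ d (d≤φ-sum m rest) ⟩
    d + φ m (sumOK (y ∷ L))   ≤⟨ d+φ≤φ-∷ m indec ⟩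
    φ m (sumOK (x ∷ y ∷ L))   ≡⟨ cong (φ m) sum≡ ⟩
    φ m (β m)                 ≡⟨ φ-at-m m ⟩
    d                         ∎))
    where open ℤP.≤-Reasoning

  -- A part β k beside other parts pushes φ m above φ m (β k) + δ² ≥ φ m (β R) + δ²; a single part β k = α e f
  -- is ruled out by ψ₁ (α e f) ≤ 0 < ψ₁ (β k).
  beyond-excluded : ∀ m R e f → m + 1ℤ ≤ R → + 2 ≤ R → φ m (α e f) ≤ φ m (β R)
                  → ∀ {L} → IndecRep D (α e f) L → ∀ {k} → R ≤ k → β k ∉ L
  beyond-excluded m R e f m+1≤R 2≤R bound (_ , indec , sum≡) {k} R≤k βk∈L with ↭-extract βk∈L
  ... | L′ , L↭ = by-rest L′ (All-resp-↭ L↭ indec) (trans (sym (sumOK-↭ L↭)) sum≡)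
    where
    open ℤP.≤-Reasoning
    by-rest : ∀ L′ → All (Indecomposable D) (β k ∷ L′) → β k ⊕ sumOK L′ ≡ α e f → ⊥
    by-rest [] _ βk≡α = ℤP.<-irrefl refl (begin-strict
      0ℤ                 <⟨ 0<d ⟩
      d                  ≤⟨ d≤ψ 1ℤ (ℤP.≤-trans 2≤R R≤k) ⟩
      ψ 1ℤ (β k)         ≡⟨ cong (ψ 1ℤ) (trans (sym (⊕-identityʳ (β k))) βk≡α) ⟩
      ψ 1ℤ (α e f)       ≡⟨ ψ₁-α e f ⟩
      - (+ e * d)        ≤⟨ ℤP.neg-mono-≤ (subst (_≤ + e * d) (ℤP.*-zeroʳ (+ e))
                              (ℤP.*-monoˡ-≤-nonNeg (+ e) (ℤP.<⇒≤ 0<d))) ⟩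
      0ℤ                 ∎)
    by-rest (y ∷ M) (_ ∷ rest) βk+rest≡α = ℤP.<-irrefl refl (begin-strict
      φ m (β R)                           <⟨ <+d (φ m (β R)) ⟩
      φ m (β R) + d                       ≤⟨ ℤP.+-mono-≤ (φ-ascending m m+1≤R R≤k) (d≤φ-sum m rest) ⟩
      φ m (β k) + φ m (sumOK (y ∷ M))     ≡⟨ IsLinear.⊕-homo (φ-linear m) (β k) (sumOK (y ∷ M)) ⟨
      φ m (β k ⊕ sumOK (y ∷ M))           ≡⟨ cong (φ m) βk+rest≡α ⟩
      φ m (α e f)                         ≤⟨ bound ⟩
      φ m (β R)                           ∎)

  φ-α≤φ-β : ∀ m R e f x y T → φ m (β 0ℤ) ≡ d * + x → φ m (β 1ℤ) ≡ d * + y → φ m (β R) ≡ d * + T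
          → e ℕ.* x ℕ.+ f ℕ.* y ℕ.≤ T → φ m (α e f) ≤ φ m (β R)
  φ-α≤φ-β m R e f x y T φβ₀≡ φβ₁≡ φβR≡ ex+fy≤T = begin
    φ m (α e f)                           ≡⟨ IsLinear.combination-homo (φ-linear m) (+ e) (+ f) (β 0ℤ) (β 1ℤ) ⟩
    + e * φ m (β 0ℤ) + + f * φ m (β 1ℤ)   ≡⟨ cong₂ (λ u w → + e * u + + f * w) φβ₀≡ φβ₁≡ ⟩
    + e * (d * + x) + + f * (d * + y)     ≡⟨ identity (+ e) (+ f) d (+ x) (+ y) ⟩
    d * (+ e * + x + + f * + y)           ≡⟨ cong (d *_) cast ⟨
    d * + (e ℕ.* x ℕ.+ f ℕ.* y)           ≤⟨ ℤP.*-monoˡ-≤-nonNeg d {{ℤ.nonNegative (ℤP.<⇒≤ 0<d)}} (+≤+ ex+fy≤T) ⟩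
    d * + T                               ≡⟨ φβR≡ ⟨
    φ m (β R)                             ∎
    where
    open ℤP.≤-Reasoning
    identity : ∀ e f d x y → e * (d * x) + f * (d * y) ≡ d * (e * x + f * y)
    identity = solve-∀
    cast : + (e ℕ.* x ℕ.+ f ℕ.* y) ≡ + e * + x + + f * + y
    cast = trans (ℤP.pos-+ (e ℕ.* x) (f ℕ.* y)) (cong₂ _+_ (ℤP.pos-* e x) (ℤP.pos-* f y))

  private
    φ-rec : ∀ m → Recurrence a (λ k → φ m (β k))
    φ-rec m = Recurrence-linear (φ-linear m)

    d≡d*1 : d ≡ d * + 1
    d≡d*1 = sym (ℤP.*-identityʳ d)

    φ₋₁-β₀ : φ -1ℤ (β 0ℤ) ≡ d * + 1
    φ₋₁-β₀ = trans (φ-at-m+1 -1ℤ) d≡d*1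
    φ₋₁-β₁ : φ -1ℤ (β 1ℤ) ≡ d * + t₂ a₀
    φ₋₁-β₁ = Recurrence-next {a} (φ-rec -1ℤ) 0ℤ d 1 1 (t₂ a₀)
      (trans (φ-at-m -1ℤ) d≡d*1) φ₋₁-β₀ (t₂-recurrence a₀)
    φ₋₁-β₂ : φ -1ℤ (β (+ 2)) ≡ d * + t₃ a₀ a₁
    φ₋₁-β₂ = Recurrence-next {a} (φ-rec -1ℤ) 1ℤ d 1 (t₂ a₀) (t₃ a₀ a₁) φ₋₁-β₀ φ₋₁-β₁ (t₃-recurrence a₀ a₁)
    φ₋₁-β₃ : φ -1ℤ (β (+ 3)) ≡ d * + t₄ a₀ a₁ a₂
    φ₋₁-β₃ = Recurrence-next {a} (φ-rec -1ℤ) (+ 2) d (t₂ a₀) (t₃ a₀ a₁) (t₄ a₀ a₁ a₂)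
      φ₋₁-β₁ φ₋₁-β₂ (t₄-recurrence a₀ a₁ a₂)

    φ₋₂-β₋₁ : φ -[1+ 1 ] (β -1ℤ) ≡ d * + 1
    φ₋₂-β₋₁ = trans (φ-at-m+1 -[1+ 1 ]) d≡d*1
    φ₋₂-β₀ : φ -[1+ 1 ] (β 0ℤ) ≡ d * + t₂ a₋₁
    φ₋₂-β₀ = Recurrence-next {a} (φ-rec -[1+ 1 ]) -1ℤ d 1 1 (t₂ a₋₁)
      (trans (φ-at-m -[1+ 1 ]) d≡d*1) φ₋₂-β₋₁ (t₂-recurrence a₋₁)
    φ₋₂-β₁ : φ -[1+ 1 ] (β 1ℤ) ≡ d * + t₃ a₋₁ a₀
    φ₋₂-β₁ = Recurrence-next {a} (φ-rec -[1+ 1 ]) 0ℤ d 1 (t₂ a₋₁) (t₃ a₋₁ a₀)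
      φ₋₂-β₋₁ φ₋₂-β₀ (t₃-recurrence a₋₁ a₀)
    φ₋₂-β₂ : φ -[1+ 1 ] (β (+ 2)) ≡ d * + t₄ a₋₁ a₀ a₁
    φ₋₂-β₂ = Recurrence-next {a} (φ-rec -[1+ 1 ]) 1ℤ d (t₂ a₋₁) (t₃ a₋₁ a₀) (t₄ a₋₁ a₀ a₁)
      φ₋₂-β₀ φ₋₂-β₁ (t₄-recurrence a₋₁ a₀ a₁)
    φ₋₂-β₃ : φ -[1+ 1 ] (β (+ 3)) ≡ d * + t₅ a₋₁ a₀ a₁ a₂
    φ₋₂-β₃ = Recurrence-next {a} (φ-rec -[1+ 1 ]) (+ 2) d (t₃ a₋₁ a₀) (t₄ a₋₁ a₀ a₁) (t₅ a₋₁ a₀ a₁ a₂)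
      φ₋₂-β₁ φ₋₂-β₂ (t₅-recurrence a₋₁ a₀ a₁ a₂)

  β∉-BelowCorner : ∀ {e f} → BelowCorner a₀ a₁ e f
                 → ∀ {L} → IndecRep D (α e f) L → ∀ {k} → + 2 ≤ k → β k ∉ L
  β∉-BelowCorner {e} {f} below = beyond-excluded -1ℤ (+ 2) e f (+≤+ z≤n) ℤP.≤-refl
    (φ-α≤φ-β -1ℤ (+ 2) e f 1 (t₂ a₀) (t₃ a₀ a₁) φ₋₁-β₀ φ₋₁-β₁ φ₋₁-β₂ (BelowCorner-bound below))

  β∉-Strip : ∀ {e f} → Strip a₋₁ a₀ a₁ e f
           → ∀ {L} → IndecRep D (α e f) L → ∀ {k} → + 2 ≤ k → β k ∉ L
  β∉-Strip {e} {f} strip = beyond-excluded -[1+ 1 ] (+ 2) e f -≤+ ℤP.≤-refl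
    (φ-α≤φ-β -[1+ 1 ] (+ 2) e f (t₂ a₋₁) (t₃ a₋₁ a₀) (t₄ a₋₁ a₀ a₁) φ₋₂-β₀ φ₋₂-β₁ φ₋₂-β₂ (Strip-bound strip))

  β∉-Strip-mirror : ∀ {e f} → Strip a₂ a₁ a₀ f e
                  → ∀ {L} → IndecRep D (α e f) L → ∀ {k} → + 3 ≤ k → β k ∉ L
  β∉-Strip-mirror {e} {f} strip = beyond-excluded -1ℤ (+ 3) e f (+≤+ z≤n) (+≤+ (s≤s (s≤s z≤n)))
    (φ-α≤φ-β -1ℤ (+ 3) e f 1 (t₂ a₀) (t₄ a₀ a₁ a₂) φ₋₁-β₀ φ₋₁-β₁ φ₋₁-β₃ (Strip-mirror-bound strip))

  β∉-Corner : ∀ {e f} → Corner a₋₁ a₀ a₁ a₂ e f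
            → ∀ {L} → IndecRep D (α e f) L → ∀ {k} → + 3 ≤ k → β k ∉ L
  β∉-Corner {e} {f} corner = beyond-excluded -[1+ 1 ] (+ 3) e f -≤+ (+≤+ (s≤s (s≤s z≤n)))
    (φ-α≤φ-β -[1+ 1 ] (+ 3) e f (t₂ a₋₁) (t₃ a₋₁ a₀) (t₅ a₋₁ a₀ a₁ a₂) φ₋₂-β₀ φ₋₂-β₁ φ₋₂-β₃ (Corner-bound corner))

module Partitions {D : ℕ} (C : Chain D) where

  open Exclusion C public
  private
    module Mirror = Exclusion (reflect C)

  IsBasic : OK → Set
  IsBasic x = x ≡ β 0ℤ ⊎ x ≡ β 1ℤ

  basicPartition : ℕ → ℕ → List OK
  basicPartition e f = replicate e (β 0ℤ) ++ replicate f (β 1ℤ)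

  basicPartition-basic : ∀ e f → All IsBasic (basicPartition e f)
  basicPartition-basic e f = AllP.++⁺ (AllP.replicate⁺ e (inj₁ refl)) (AllP.replicate⁺ f (inj₂ refl))

  basicPartition-indecomposable : ∀ e f → All (Indecomposable D) (basicPartition e f)
  basicPartition-indecomposable e f = All.map [ indecomposable-basic₀ , indecomposable-basic₁ ]′ (basicPartition-basic e f)
    where
    indecomposable-basic₀ : ∀ {x} → x ≡ β 0ℤ → Indecomposable D x
    indecomposable-basic₀ refl = indecomposable 0ℤ
    indecomposable-basic₁ : ∀ {x} → x ≡ β 1ℤ → Indecomposable D x
    indecomposable-basic₁ refl = indecomposable 1ℤ

  sumOK-replicate-++ : ∀ n x M → sumOK (replicate n x ++ M) ≡ ((+ n) · x) ⊕ sumOK M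
  sumOK-replicate-++ zero x M = sym (cong₂ _,_ (ℤP.+-identityˡ _) (ℤP.+-identityˡ _))
  sumOK-replicate-++ (suc n) (p , q) M =
    trans (cong ((p , q) ⊕_) (sumOK-replicate-++ n (p , q) M)) (cong₂ _,_ (identity p (+ n) _) (identity q (+ n) _))
    where
    identity : ∀ p n m → p + (n * p + m) ≡ (1ℤ + n) * p + m
    identity = solve-∀

  sumOK-basicPartition : ∀ e f → sumOK (basicPartition e f) ≡ α e f
  sumOK-basicPartition e f = trans (sumOK-replicate-++ e (β 0ℤ) (replicate f (β 1ℤ)))
    (cong (((+ e) · β 0ℤ) ⊕_) (trans (cong sumOK (sym (ListP.++-identityʳ (replicate f (β 1ℤ)))))
      (trans (sumOK-replicate-++ f (β 1ℤ) []) (⊕-identityʳ ((+ f) · β 1ℤ)))))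

  basicPartition-rep : ∀ e f → IndecRep D (α (suc e) f) (basicPartition (suc e) f)
  basicPartition-rep e f = (λ ()) , basicPartition-indecomposable (suc e) f , sumOK-basicPartition (suc e) f

  ∷-rep : ∀ k {γ L} → All (Indecomposable D) L → sumOK L ≡ γ → IndecRep D (β k ⊕ γ) (β k ∷ L)
  ∷-rep k L-indec sum≡ = (λ ()) , indecomposable k ∷ L-indec , cong (β k ⊕_) sum≡

  β∉basicPartition : ∀ {k} e f → ¬ k ≡ 0ℤ → ¬ k ≡ 1ℤ → β k ∉ basicPartition e f
  β∉basicPartition e f k≢0 k≢1 βk∈ with All.lookup (basicPartition-basic e f) βk∈
  ... | inj₁ βk≡β₀ = k≢0 (β-injective βk≡β₀)
  ... | inj₂ βk≡β₁ = k≢1 (β-injective βk≡β₁)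

  β∉∷ : ∀ {k j L} → ¬ k ≡ j → β k ∉ L → β k ∉ β j ∷ L
  β∉∷ k≢j _ (here βk≡βj) = k≢j (β-injective βk≡βj)
  β∉∷ _ βk∉L (there βk∈L) = βk∉L βk∈L

  basicPartition-shape : ∀ {L} → All IsBasic L → ∃[ e ] ∃[ f ] L ↭ basicPartition e f
  basicPartition-shape [] = 0 , 0 , ↭-refl
  basicPartition-shape (inj₁ refl ∷ rest) with basicPartition-shape rest
  ... | e , f , p = suc e , f , prep (β 0ℤ) p
  basicPartition-shape (inj₂ refl ∷ rest) with basicPartition-shape rest
  ... | e , f , p = e , suc f
    , ↭-trans (prep (β 1ℤ) p) (↭-sym (shift (β 1ℤ) (replicate e (β 0ℤ)) (replicate f (β 1ℤ))))

  ↭-basicPartition : ∀ {e f L} → All IsBasic L → sumOK L ≡ α e f → L ↭ basicPartition e f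
  ↭-basicPartition {e} {f} {L} L-basic sum≡ = by-shape (basicPartition-shape L-basic)
    where
    by-shape : ∃[ e′ ] ∃[ f′ ] L ↭ basicPartition e′ f′ → L ↭ basicPartition e f
    by-shape (e′ , f′ , L↭) = subst₂ (λ u w → L ↭ basicPartition u w) (proj₁ same) (proj₂ same) L↭
      where
      same : e′ ≡ e × f′ ≡ f
      same = α-injective {e′} {f′} {e} {f} (trans (sym (sumOK-basicPartition e′ f′)) (trans (sym (sumOK-↭ L↭)) sum≡))

  basic-parts : ∀ {L} → All (Indecomposable D) L → (∀ {k} → + 2 ≤ k → β k ∉ L) → (∀ {k} → k ≤ -1ℤ → β k ∉ L)
              → All IsBasic L
  basic-parts {L} L-indec none-right none-left =
    All.tabulate (λ {x} x∈L → by-index x∈L (exhaustive x (All.lookup L-indec x∈L)))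
    where
    by-index : ∀ {x} → x ∈ L → ∃[ k ] β k ≡ x → IsBasic x
    by-index _ (+ 0 , refl) = inj₁ refl
    by-index _ (+ 1 , refl) = inj₂ refl
    by-index x∈L (+ suc (suc n) , refl) = ⊥-elim (none-right (+≤+ (s≤s (s≤s z≤n))) x∈L)
    by-index x∈L (-[1+ n ] , refl) = ⊥-elim (none-left (-≤- z≤n) x∈L)

  remove-part : ∀ {γ γ′ x L} → IndecRep D γ L → x ∈ L → γ ≡ x ⊕ γ′ → ¬ γ′ ≡ (0ℤ , 0ℤ)
              → ∃[ L′ ] (L ↭ x ∷ L′ × IndecRep D γ′ L′)
  remove-part {γ} {γ′} {x} (_ , L-indec , sum≡) x∈L γ≡ γ′≢0 with ↭-extract x∈L
  ... | L′ , L↭ = L′ , L↭ , L′≢[] , tail-indec (All-resp-↭ L↭ L-indec) , sum′≡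
    where
    tail-indec : ∀ {y M} → All (Indecomposable D) (y ∷ M) → All (Indecomposable D) M
    tail-indec (_ ∷ M-indec) = M-indec
    sum′≡ : sumOK L′ ≡ γ′
    sum′≡ = ⊕-cancelˡ x (sumOK L′) γ′ (trans (sym (sumOK-↭ L↭)) (trans sum≡ γ≡))
    L′≢[] : ¬ L′ ≡ []
    L′≢[] refl = γ′≢0 (sym sum′≡)

  mirror-α : ∀ e f → Mirror.α f e ≡ α e f
  mirror-α e f = ⊕-comm ((+ f) · β 1ℤ) ((+ e) · β 0ℤ)

  mirror-rep : ∀ {e f L} → IndecRep D (α e f) L → IndecRep D (Mirror.α f e) L
  mirror-rep {e} {f} {L} = subst (λ γ → IndecRep D γ L) (sym (mirror-α e f))

  private
    mirror-∈ : ∀ {k L} → β k ∈ L → Mirror.β (1ℤ - k) ∈ L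
    mirror-∈ {k} {L} = subst (λ i → β i ∈ L) (sym (identity k))
      where
      identity : ∀ k → 1ℤ - (1ℤ - k) ≡ k
      identity = solve-∀

    mirror-index : ∀ {k} n → k ≤ - (+ n) → + suc n ≤ 1ℤ - k
    mirror-index {k} n k≤-n = ℤP.+-monoʳ-≤ 1ℤ (subst (_≤ - k) (ℤP.neg-involutive (+ n)) (ℤP.neg-mono-≤ k≤-n))

  β∉-BelowCorner-left : ∀ {e f} → BelowCorner a₀ a₁ e f
                      → ∀ {L} → IndecRep D (α e f) L → ∀ {k} → k ≤ -1ℤ → β k ∉ L
  β∉-BelowCorner-left {e} {f} (e≤ , f≤ , ≢corner) rep k≤-1 βk∈L =
    Mirror.β∉-BelowCorner {f} {e} (f≤ , e≤ , λ (f≡ , e≡) → ≢corner (e≡ , f≡))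
      (mirror-rep {e} {f} rep) (mirror-index 1 k≤-1) (mirror-∈ βk∈L)

  β∉-Strip-left : ∀ {e f} → Strip a₋₁ a₀ a₁ e f
                → ∀ {L} → IndecRep D (α e f) L → ∀ {k} → k ≤ -[1+ 1 ] → β k ∉ L
  β∉-Strip-left {e} {f} strip rep k≤-2 βk∈L =
    Mirror.β∉-Strip-mirror {f} {e} strip (mirror-rep {e} {f} rep) (mirror-index 2 k≤-2) (mirror-∈ βk∈L)

  β∉-Corner-left : ∀ {e f} → Corner a₋₁ a₀ a₁ a₂ e f
                 → ∀ {L} → IndecRep D (α e f) L → ∀ {k} → k ≤ -[1+ 1 ] → β k ∉ L
  β∉-Corner-left {e} {f} (e≡ , f≡ , not-all-zero) rep k≤-2 βk∈L =
    Mirror.β∉-Corner {f} {e} (f≡ , e≡ , λ (z₂ , z₁ , z₀ , z₋₁) → not-all-zero (z₋₁ , z₀ , z₁ , z₂))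
      (mirror-rep {e} {f} rep) (mirror-index 2 k≤-2) (mirror-∈ βk∈L)

  coords : ℤ → ℤ → OK
  coords x y = (x · β 0ℤ) ⊕ (y · β 1ℤ)

  coords-⊕ : ∀ x y x′ y′ → coords x y ⊕ coords x′ y′ ≡ coords (x + x′) (y + y′)
  coords-⊕ x y x′ y′ = cong₂ _,_ (identity (proj₁ (β 0ℤ)) (proj₁ (β 1ℤ))) (identity (proj₂ (β 0ℤ)) (proj₂ (β 1ℤ)))
    where
    identity : ∀ p q → (x * p + y * q) + (x′ * p + y′ * q) ≡ (x + x′) * p + (y + y′) * q
    identity p q = solve-identity x y x′ y′ p q
      where
      solve-identity : ∀ x y x′ y′ p q → (x * p + y * q) + (x′ * p + y′ * q) ≡ (x + x′) * p + (y + y′) * q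
      solve-identity = solve-∀

  coords-previous : ∀ v x y x′ y′ r → v · coords x y ≡ r ⊕ coords x′ y′ → r ≡ coords (v * x - x′) (v * y - y′)
  coords-previous v x y x′ y′ (r₁ , r₂) eq =
    cong₂ _,_ (component (proj₁ (β 0ℤ)) (proj₁ (β 1ℤ)) r₁ (cong proj₁ eq))
              (component (proj₂ (β 0ℤ)) (proj₂ (β 1ℤ)) r₂ (cong proj₂ eq))
    where
    identity₁ : ∀ r s → r ≡ (r + s) - s
    identity₁ = solve-∀
    identity₂ : ∀ v x y x′ y′ p q → v * (x * p + y * q) - (x′ * p + y′ * q) ≡ (v * x - x′) * p + (v * y - y′) * q
    identity₂ = solve-∀
    component : ∀ p q r → v * (x * p + y * q) ≡ r + (x′ * p + y′ * q) → r ≡ (v * x - x′) * p + (v * y - y′) * q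
    component p q r h = trans (identity₁ r (x′ * p + y′ * q))
      (trans (cong (_- (x′ * p + y′ * q)) (sym h)) (identity₂ v x y x′ y′ p q))

  v : ℤ → ℤ
  v k = + (2 ℕ.+ a k)

  β₀-coords : β 0ℤ ≡ coords 1ℤ 0ℤ
  β₀-coords = cong₂ _,_ (identity (proj₁ (β 0ℤ)) (proj₁ (β 1ℤ))) (identity (proj₂ (β 0ℤ)) (proj₂ (β 1ℤ)))
    where
    identity : ∀ p q → p ≡ 1ℤ * p + 0ℤ * q
    identity = solve-∀

  β₁-coords : β 1ℤ ≡ coords 0ℤ 1ℤ
  β₁-coords = cong₂ _,_ (identity (proj₁ (β 0ℤ)) (proj₁ (β 1ℤ))) (identity (proj₂ (β 0ℤ)) (proj₂ (β 1ℤ)))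
    where
    identity : ∀ p q → q ≡ 0ℤ * p + 1ℤ * q
    identity = solve-∀

  β₋₁-coords : β -1ℤ ≡ coords (v 0ℤ) -1ℤ
  β₋₁-coords = trans (coords-previous (v 0ℤ) 1ℤ 0ℤ 0ℤ 1ℤ (β -1ℤ)
      (subst₂ (λ x y → v 0ℤ · x ≡ β -1ℤ ⊕ y) β₀-coords β₁-coords (recurrence 0ℤ)))
    (cong₂ coords (identity₁ (v 0ℤ)) (identity₂ (v 0ℤ)))
    where
    identity₁ : ∀ v → v * 1ℤ - 0ℤ ≡ v
    identity₁ = solve-∀
    identity₂ : ∀ v → v * 0ℤ - 1ℤ ≡ -1ℤ
    identity₂ = solve-∀

  β₂-coords : β (+ 2) ≡ coords -1ℤ (v 1ℤ)
  β₂-coords = trans (coords-previous (v 1ℤ) 0ℤ 1ℤ 1ℤ 0ℤ (β (+ 2))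
      (subst₂ (λ x y → v 1ℤ · x ≡ β (+ 2) ⊕ y) β₁-coords β₀-coords
        (trans (recurrence 1ℤ) (⊕-comm (β 0ℤ) (β (+ 2))))))
    (cong₂ coords (identity₁ (v 1ℤ)) (identity₂ (v 1ℤ)))
    where
    identity₁ : ∀ v → v * 0ℤ - 1ℤ ≡ -1ℤ
    identity₁ = solve-∀
    identity₂ : ∀ v → v * 1ℤ - 0ℤ ≡ v
    identity₂ = solve-∀

  β₋₂-coords : β -[1+ 1 ] ≡ coords (v -1ℤ * v 0ℤ - 1ℤ) (- v -1ℤ)
  β₋₂-coords = trans (coords-previous (v -1ℤ) (v 0ℤ) -1ℤ 1ℤ 0ℤ (β -[1+ 1 ])
      (subst₂ (λ x y → v -1ℤ · x ≡ β -[1+ 1 ] ⊕ y) β₋₁-coords β₀-coords (recurrence -1ℤ)))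
    (cong (coords (v -1ℤ * v 0ℤ - 1ℤ)) (identity (v -1ℤ)))
    where
    identity : ∀ v → v * -1ℤ - 0ℤ ≡ - v
    identity = solve-∀

  β₃-coords : β (+ 3) ≡ coords (- v (+ 2)) (v (+ 2) * v 1ℤ - 1ℤ)
  β₃-coords = trans (coords-previous (v (+ 2)) -1ℤ (v 1ℤ) 0ℤ 1ℤ (β (+ 3))
      (subst₂ (λ x y → v (+ 2) · x ≡ β (+ 3) ⊕ y) β₂-coords β₁-coords
        (trans (recurrence (+ 2)) (⊕-comm (β 1ℤ) (β (+ 3))))))
    (cong (λ x → coords x (v (+ 2) * v 1ℤ - 1ℤ)) (identity (v (+ 2))))
    where
    identity : ∀ v → v * -1ℤ - 0ℤ ≡ - v
    identity = solve-∀

  carry-left : ∀ e f → α (2 ℕ.+ a₀ ℕ.+ e) f ≡ β -1ℤ ⊕ α e (suc f)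
  carry-left e f = sym (trans (cong (_⊕ α e (suc f)) β₋₁-coords) (coords-⊕ (v 0ℤ) -1ℤ (+ e) (+ suc f)))

  carry-right : ∀ e f → α e (2 ℕ.+ a₁ ℕ.+ f) ≡ β (+ 2) ⊕ α (suc e) f
  carry-right e f = sym (trans (cong (_⊕ α (suc e) f) β₂-coords) (coords-⊕ -1ℤ (v 1ℤ) (+ suc e) (+ f)))

  corner-split : α (1 ℕ.+ a₀) (1 ℕ.+ a₁) ≡ β -1ℤ ⊕ β (+ 2)
  corner-split = sym (trans (cong₂ _⊕_ β₋₁-coords β₂-coords) (coords-⊕ (v 0ℤ) -1ℤ -1ℤ (v 1ℤ)))

  private
    widen-right : ∀ {L} → β (+ 2) ∉ L → (∀ {k} → + 3 ≤ k → β k ∉ L) → ∀ {k} → + 2 ≤ k → β k ∉ L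
    widen-right _ _ {+ 0} (+≤+ ())
    widen-right _ _ {+ 1} (+≤+ (s≤s ()))
    widen-right β₂∉L _ {+ 2} _ = β₂∉L
    widen-right _ none {+ suc (suc (suc n))} _ = none (+≤+ (s≤s (s≤s (s≤s z≤n))))

    widen-left : ∀ {L} → β -1ℤ ∉ L → (∀ {k} → k ≤ -[1+ 1 ] → β k ∉ L) → ∀ {k} → k ≤ -1ℤ → β k ∉ L
    widen-left _ _ {+ _} ()
    widen-left β₋₁∉L _ { -[1+ 0 ]} _ = β₋₁∉L
    widen-left _ none { -[1+ suc n ]} _ = none (-≤- (s≤s z≤n))

  BelowCorner-unique : ∀ {e f L} → BelowCorner a₀ a₁ e f → IndecRep D (α e f) L → L ↭ basicPartition e f
  BelowCorner-unique {e} {f} below rep@(_ , L-indec , sum≡) = ↭-basicPartition {e} {f}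
    (basic-parts L-indec (β∉-BelowCorner {e} {f} below rep) (β∉-BelowCorner-left {e} {f} below rep)) sum≡

  BelowCorner⇒¬two : ∀ {e f} → BelowCorner a₀ a₁ e f → ¬ PartitionCount D (α e f) 2
  BelowCorner⇒¬two {e} {f} below = unique⇒¬partitionCount-2 (basicPartition e f) (λ L → BelowCorner-unique {e} {f} below)

  basicPartition-rep₁ : ∀ e f → IndecRep D (α e (suc f)) (basicPartition e (suc f))
  basicPartition-rep₁ e f = nonempty e , basicPartition-indecomposable e (suc f) , sumOK-basicPartition e (suc f)
    where
    nonempty : ∀ e → ¬ basicPartition e (suc f) ≡ []
    nonempty zero ()
    nonempty (suc e) ()

  carry-left-rep : ∀ {e f L} → IndecRep D (α e (suc f)) L → IndecRep D (α (2 ℕ.+ a₀ ℕ.+ e) f) (β -1ℤ ∷ L)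
  carry-left-rep {e} {f} {L} (_ , L-indec , sum≡) =
    subst (λ γ → IndecRep D γ (β -1ℤ ∷ L)) (sym (carry-left e f)) (∷-rep -1ℤ L-indec sum≡)

  carry-right-rep : ∀ {e f L} → IndecRep D (α (suc e) f) L → IndecRep D (α e (2 ℕ.+ a₁ ℕ.+ f)) (β (+ 2) ∷ L)
  carry-right-rep {e} {f} {L} (_ , L-indec , sum≡) =
    subst (λ γ → IndecRep D γ (β (+ 2) ∷ L)) (sym (carry-right e f)) (∷-rep (+ 2) L-indec sum≡)

  α≢0 : ∀ e f → ¬ α e (suc f) ≡ (0ℤ , 0ℤ)
  α≢0 e f α≡0 = ℕP.1+n≢0 (proj₂ (α-injective {e} {suc f} {0} {0} α≡0))

  Strip-carried : ∀ {e′ f L} → Strip a₋₁ a₀ a₁ (2 ℕ.+ a₀ ℕ.+ e′) f → IndecRep D (α (2 ℕ.+ a₀ ℕ.+ e′) f) L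
                → β -1ℤ ∈ L → L ↭ β -1ℤ ∷ basicPartition e′ (suc f)
  Strip-carried {e′} {f} {L} (_ , e≤ , f≤ , ≢₁ , _ , _) rep β₋₁∈L =
    by-rest (remove-part {α (2 ℕ.+ a₀ ℕ.+ e′) f} {α e′ (suc f)} rep β₋₁∈L (carry-left e′ f) (α≢0 e′ f))
    where
    below : BelowCorner a₀ a₁ e′ (suc f)
    below = ℕP.+-cancelˡ-≤ (2 ℕ.+ a₀) e′ (1 ℕ.+ a₀) e≤ , s≤s f≤
          , λ (e′≡ , 1+f≡) → ≢₁ (cong (2 ℕ.+ a₀ ℕ.+_) e′≡ , ℕP.suc-injective 1+f≡)
    by-rest : ∃[ L′ ] (L ↭ β -1ℤ ∷ L′ × IndecRep D (α e′ (suc f)) L′) → L ↭ β -1ℤ ∷ basicPartition e′ (suc f)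
    by-rest (L′ , L↭ , rep′) = ↭-trans L↭ (prep (β -1ℤ) (BelowCorner-unique {e′} {suc f} below rep′))

  Strip-partitions : ∀ {e′ f L} → Strip a₋₁ a₀ a₁ (2 ℕ.+ a₀ ℕ.+ e′) f → IndecRep D (α (2 ℕ.+ a₀ ℕ.+ e′) f) L
                   → L ↭ basicPartition (2 ℕ.+ a₀ ℕ.+ e′) f ⊎ L ↭ β -1ℤ ∷ basicPartition e′ (suc f)
  Strip-partitions {e′} {f} {L} strip rep@(_ , L-indec , sum≡) with β -1ℤ ∈? L
  ... | yes β₋₁∈L = inj₂ (Strip-carried {e′} {f} strip rep β₋₁∈L)
  ... | no β₋₁∉L = inj₁ (↭-basicPartition {2 ℕ.+ a₀ ℕ.+ e′} {f} (basic-parts L-indec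
    (β∉-Strip {2 ℕ.+ a₀ ℕ.+ e′} {f} strip rep)
    (widen-left β₋₁∉L (β∉-Strip-left {2 ℕ.+ a₀ ℕ.+ e′} {f} strip rep))) sum≡)

  Strip⇒two : ∀ {e f} → Strip a₋₁ a₀ a₁ e f → PartitionCount D (α e f) 2
  Strip⇒two {e} {f} strip with ℕP.m≤n⇒∃[o]m+o≡n (proj₁ strip)
  ... | e′ , refl = partitionCount-2 (basicPartition (2 ℕ.+ a₀ ℕ.+ e′) f) (β -1ℤ ∷ basicPartition e′ (suc f))
    (basicPartition-rep (suc a₀ ℕ.+ e′) f) (carry-left-rep {e′} {f} (basicPartition-rep₁ e′ f))
    (λ P↭Q → ∈-separates (here refl) (β∉basicPartition (2 ℕ.+ a₀ ℕ.+ e′) f (λ ()) (λ ())) (↭-sym P↭Q))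
    (λ L → Strip-partitions {e′} {f} {L} strip)

  Corner-via-β₋₁ : ∀ {L} → IndecRep D (α (1 ℕ.+ a₀) (1 ℕ.+ a₁)) L → β -1ℤ ∈ L → L ↭ β -1ℤ ∷ β (+ 2) ∷ []
  Corner-via-β₋₁ {L} rep β₋₁∈L =
    by-rest (remove-part {α (1 ℕ.+ a₀) (1 ℕ.+ a₁)} {β (+ 2)} rep β₋₁∈L corner-split (β≢0 (+ 2)))
    where
    by-rest : ∃[ L′ ] (L ↭ β -1ℤ ∷ L′ × IndecRep D (β (+ 2)) L′) → L ↭ β -1ℤ ∷ β (+ 2) ∷ []
    by-rest (L′ , L↭ , rep′) = ↭-trans L↭ (prep (β -1ℤ) (partition-of-β (+ 2) rep′))

  Corner-via-β₂ : ∀ {L} → IndecRep D (α (1 ℕ.+ a₀) (1 ℕ.+ a₁)) L → β (+ 2) ∈ L → L ↭ β -1ℤ ∷ β (+ 2) ∷ []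
  Corner-via-β₂ {L} rep β₂∈L = by-rest (remove-part {α (1 ℕ.+ a₀) (1 ℕ.+ a₁)} {β -1ℤ} rep β₂∈L
      (trans corner-split (⊕-comm (β -1ℤ) (β (+ 2)))) (β≢0 -1ℤ))
    where
    by-rest : ∃[ L′ ] (L ↭ β (+ 2) ∷ L′ × IndecRep D (β -1ℤ) L′) → L ↭ β -1ℤ ∷ β (+ 2) ∷ []
    by-rest (L′ , L↭ , rep′) =
      ↭-trans L↭ (↭-trans (prep (β (+ 2)) (partition-of-β -1ℤ rep′)) (swap (β (+ 2)) (β -1ℤ) ↭-refl))

  Corner-basic : ∀ {L} → Corner a₋₁ a₀ a₁ a₂ (1 ℕ.+ a₀) (1 ℕ.+ a₁) → IndecRep D (α (1 ℕ.+ a₀) (1 ℕ.+ a₁)) L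
               → β -1ℤ ∉ L → β (+ 2) ∉ L → L ↭ basicPartition (1 ℕ.+ a₀) (1 ℕ.+ a₁)
  Corner-basic corner rep@(_ , L-indec , sum≡) β₋₁∉L β₂∉L = ↭-basicPartition {1 ℕ.+ a₀} {1 ℕ.+ a₁} (basic-parts L-indec
    (widen-right β₂∉L (β∉-Corner {1 ℕ.+ a₀} {1 ℕ.+ a₁} corner rep))
    (widen-left β₋₁∉L (β∉-Corner-left {1 ℕ.+ a₀} {1 ℕ.+ a₁} corner rep))) sum≡

  Corner-partitions : ∀ {L} → Corner a₋₁ a₀ a₁ a₂ (1 ℕ.+ a₀) (1 ℕ.+ a₁) → IndecRep D (α (1 ℕ.+ a₀) (1 ℕ.+ a₁)) L
                    → L ↭ basicPartition (1 ℕ.+ a₀) (1 ℕ.+ a₁) ⊎ L ↭ β -1ℤ ∷ β (+ 2) ∷ []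
  Corner-partitions {L} corner rep with β -1ℤ ∈? L | β (+ 2) ∈? L
  ... | yes β₋₁∈L | _         = inj₂ (Corner-via-β₋₁ rep β₋₁∈L)
  ... | no _      | yes β₂∈L  = inj₂ (Corner-via-β₂ rep β₂∈L)
  ... | no β₋₁∉L  | no β₂∉L   = inj₁ (Corner-basic corner rep β₋₁∉L β₂∉L)

  corner-rep : IndecRep D (α (1 ℕ.+ a₀) (1 ℕ.+ a₁)) (β -1ℤ ∷ β (+ 2) ∷ [])
  corner-rep = subst (λ γ → IndecRep D γ (β -1ℤ ∷ β (+ 2) ∷ [])) (sym corner-split)
    (∷-rep -1ℤ (indecomposable (+ 2) ∷ []) (⊕-identityʳ (β (+ 2))))

  Corner⇒two : ∀ {e f} → Corner a₋₁ a₀ a₁ a₂ e f → PartitionCount D (α e f) 2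
  Corner⇒two corner@(refl , refl , _) = partitionCount-2 (basicPartition (1 ℕ.+ a₀) (1 ℕ.+ a₁)) (β -1ℤ ∷ β (+ 2) ∷ [])
    (basicPartition-rep a₀ (1 ℕ.+ a₁)) corner-rep
    (λ P↭Q → ∈-separates (here refl) (β∉basicPartition (1 ℕ.+ a₀) (1 ℕ.+ a₁) (λ ()) (λ ())) (↭-sym P↭Q))
    (λ L → Corner-partitions {L} corner)

  private
    v≡2 : ∀ {k} → a k ≡ 0 → v k ≡ + 2
    v≡2 a≡0 = cong (λ n → + (2 ℕ.+ n)) a≡0

    β₋₂⊕-coords : ∀ x y → β -[1+ 1 ] ⊕ coords x y ≡ coords (v -1ℤ * v 0ℤ - 1ℤ + x) (- v -1ℤ + y)
    β₋₂⊕-coords x y = trans (cong (_⊕ coords x y) β₋₂-coords) (coords-⊕ (v -1ℤ * v 0ℤ - 1ℤ) (- v -1ℤ) x y)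

  -- For v₋₁ = 2 the recurrence gives β₋₂ = (2 v₀ − 1) β₀ − 2 β₁.
  split-β₋₂ : a₋₁ ≡ 0 → ∀ f → α ((2 ℕ.+ a₀) ℕ.+ (1 ℕ.+ a₀)) f ≡ β -[1+ 1 ] ⊕ α 0 (2 ℕ.+ f)
  split-β₋₂ a₋₁≡0 f = sym (trans (β₋₂⊕-coords (+ 0) (+ (2 ℕ.+ f)))
    (cong₂ coords (trans (cong (λ w → w * v 0ℤ - 1ℤ + + 0) (v≡2 a₋₁≡0)) (identity (+ a₀)))
                  (cong (λ w → - w + + (2 ℕ.+ f)) (v≡2 a₋₁≡0))))
    where
    identity : ∀ A → + 2 * (+ 2 + A) - 1ℤ + 0ℤ ≡ + 2 + A + (1ℤ + A)
    identity = solve-∀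

  split-β₋₂-β₂ : a₋₁ ≡ 0 → α ((2 ℕ.+ a₀) ℕ.+ a₀) a₁ ≡ β -[1+ 1 ] ⊕ β (+ 2)
  split-β₋₂-β₂ a₋₁≡0 = sym (trans (cong (β -[1+ 1 ] ⊕_) β₂-coords) (trans (β₋₂⊕-coords -1ℤ (v 1ℤ))
    (cong₂ coords (trans (cong (λ w → w * v 0ℤ - 1ℤ + -1ℤ) (v≡2 a₋₁≡0)) (identity (+ a₀)))
                  (cong (λ w → - w + v 1ℤ) (v≡2 a₋₁≡0)))))
    where
    identity : ∀ A → + 2 * (+ 2 + A) - 1ℤ + -1ℤ ≡ + 2 + A + A
    identity = solve-∀

  split-β₋₂-β₃ : a₋₁ ≡ 0 → a₀ ≡ 0 → a₁ ≡ 0 → a₂ ≡ 0 → α 1 1 ≡ β -[1+ 1 ] ⊕ β (+ 3)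
  split-β₋₂-β₃ a₋₁≡0 a₀≡0 a₁≡0 a₂≡0 = sym (trans (cong (β -[1+ 1 ] ⊕_) β₃-coords)
    (trans (β₋₂⊕-coords (- v (+ 2)) (v (+ 2) * v 1ℤ - 1ℤ))
           (at-two (v≡2 a₋₁≡0) (v≡2 a₀≡0) (v≡2 a₁≡0) (v≡2 a₂≡0))))
    where
    at-two : ∀ {x y z w} → x ≡ + 2 → y ≡ + 2 → z ≡ + 2 → w ≡ + 2
           → coords (x * y - 1ℤ + - w) (- x + (w * z - 1ℤ)) ≡ coords 1ℤ 1ℤ
    at-two refl refl refl refl = refl

  private
    β₋₁∉basic : ∀ e f → β -1ℤ ∉ basicPartition e f
    β₋₁∉basic e f = β∉basicPartition e f (λ ()) (λ ())

    β₂∉basic : ∀ e f → β (+ 2) ∉ basicPartition e f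
    β₂∉basic e f = β∉basicPartition e f (λ ()) (λ ())

    β₋₂∉basic : ∀ e f → β -[1+ 1 ] ∉ basicPartition e f
    β₋₂∉basic e f = β∉basicPartition e f (λ ()) (λ ())

    separated-by : ∀ {x L M} → x ∈ M → x ∉ L → ¬ (L ↭ M)
    separated-by x∈M x∉L L↭M = ∈-separates x∈M x∉L (↭-sym L↭M)

  -- Outside the regions (1)–(3) three partitions are exhibited, told apart by their parts among β₋₂, β₋₁, β₂.
  ¬two-2v₀≤e : ∀ e f → ¬ PartitionCount D (α (2 ℕ.+ a₀ ℕ.+ (2 ℕ.+ a₀ ℕ.+ e)) f) 2
  ¬two-2v₀≤e e f = three⇒¬partitionCount-2 _ _ _
    (basicPartition-rep (suc a₀ ℕ.+ (2 ℕ.+ a₀ ℕ.+ e)) f)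
    (carry-left-rep {2 ℕ.+ a₀ ℕ.+ e} {f} (basicPartition-rep₁ (2 ℕ.+ a₀ ℕ.+ e) f))
    (carry-left-rep {2 ℕ.+ a₀ ℕ.+ e} {f} (carry-left-rep {e} {suc f} (basicPartition-rep₁ e (suc f))))
    (separated-by (here refl) (β₋₁∉basic (2 ℕ.+ a₀ ℕ.+ (2 ℕ.+ a₀ ℕ.+ e)) f))
    (separated-by (here refl) (β₋₁∉basic (2 ℕ.+ a₀ ℕ.+ (2 ℕ.+ a₀ ℕ.+ e)) f))
    (λ P₂↭P₃ → separated-by (here refl) (β₋₁∉basic (2 ℕ.+ a₀ ℕ.+ e) (suc f)) (drop-mid [] [] P₂↭P₃))

  ¬two-v₀≤e-v₁≤f : ∀ e f → ¬ PartitionCount D (α (2 ℕ.+ a₀ ℕ.+ e) (2 ℕ.+ a₁ ℕ.+ f)) 2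
  ¬two-v₀≤e-v₁≤f e f = three⇒¬partitionCount-2 _ _ _
    (basicPartition-rep (suc a₀ ℕ.+ e) (2 ℕ.+ a₁ ℕ.+ f))
    (carry-left-rep {e} {2 ℕ.+ a₁ ℕ.+ f} (basicPartition-rep₁ e (2 ℕ.+ a₁ ℕ.+ f)))
    (carry-right-rep {2 ℕ.+ a₀ ℕ.+ e} {f} (basicPartition-rep (2 ℕ.+ a₀ ℕ.+ e) f))
    (separated-by (here refl) (β₋₁∉basic (2 ℕ.+ a₀ ℕ.+ e) (2 ℕ.+ a₁ ℕ.+ f)))
    (separated-by (here refl) (β₂∉basic (2 ℕ.+ a₀ ℕ.+ e) (2 ℕ.+ a₁ ℕ.+ f)))
    (∈-separates (here refl) (β∉∷ (λ ()) (β₋₁∉basic (suc (2 ℕ.+ a₀ ℕ.+ e)) f)))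

  ¬two-v₀≤e-f≡v₁-1 : ∀ e → ¬ PartitionCount D (α (2 ℕ.+ a₀ ℕ.+ e) (1 ℕ.+ a₁)) 2
  ¬two-v₀≤e-f≡v₁-1 e = three⇒¬partitionCount-2 _ _ _
    (basicPartition-rep (suc a₀ ℕ.+ e) (1 ℕ.+ a₁))
    (carry-left-rep {e} {1 ℕ.+ a₁} (basicPartition-rep₁ e (1 ℕ.+ a₁)))
    (carry-left-rep {e} {1 ℕ.+ a₁} (subst (λ γ → IndecRep D γ (β (+ 2) ∷ basicPartition (suc e) 0))
      (cong (α e) (ℕP.+-identityʳ (2 ℕ.+ a₁))) (carry-right-rep {e} {0} (basicPartition-rep e 0))))
    (separated-by (here refl) (β₋₁∉basic (2 ℕ.+ a₀ ℕ.+ e) (1 ℕ.+ a₁)))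
    (separated-by (here refl) (β₋₁∉basic (2 ℕ.+ a₀ ℕ.+ e) (1 ℕ.+ a₁)))
    (separated-by (there (here refl)) (β∉∷ (λ ()) (β₂∉basic e (2 ℕ.+ a₁))))

  ¬two-e≡2v₀-1-f≡v₁-2 : ¬ PartitionCount D (α ((2 ℕ.+ a₀) ℕ.+ (1 ℕ.+ a₀)) a₁) 2
  ¬two-e≡2v₀-1-f≡v₁-2 = three⇒¬partitionCount-2 _ _ _
    (basicPartition-rep (suc a₀ ℕ.+ (1 ℕ.+ a₀)) a₁)
    (carry-left-rep {1 ℕ.+ a₀} {a₁} (basicPartition-rep a₀ (1 ℕ.+ a₁)))
    (carry-left-rep {1 ℕ.+ a₀} {a₁} corner-rep)
    (separated-by (here refl) (β₋₁∉basic ((2 ℕ.+ a₀) ℕ.+ (1 ℕ.+ a₀)) a₁))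
    (separated-by (here refl) (β₋₁∉basic ((2 ℕ.+ a₀) ℕ.+ (1 ℕ.+ a₀)) a₁))
    (separated-by (there (there (here refl))) (β∉∷ (λ ()) (β₂∉basic (1 ℕ.+ a₀) (1 ℕ.+ a₁))))

  ¬two-v₋₁≡2-e≡2v₀-1 : a₋₁ ≡ 0 → ∀ f → ¬ PartitionCount D (α ((2 ℕ.+ a₀) ℕ.+ (1 ℕ.+ a₀)) f) 2
  ¬two-v₋₁≡2-e≡2v₀-1 a₋₁≡0 f = three⇒¬partitionCount-2 _ _ _
    (basicPartition-rep (suc a₀ ℕ.+ (1 ℕ.+ a₀)) f)
    (carry-left-rep {1 ℕ.+ a₀} {f} (basicPartition-rep a₀ (suc f)))
    (subst (λ γ → IndecRep D γ (β -[1+ 1 ] ∷ basicPartition 0 (2 ℕ.+ f))) (sym (split-β₋₂ a₋₁≡0 f))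
      (∷-rep -[1+ 1 ] (basicPartition-indecomposable 0 (2 ℕ.+ f)) (sumOK-basicPartition 0 (2 ℕ.+ f))))
    (separated-by (here refl) (β₋₁∉basic ((2 ℕ.+ a₀) ℕ.+ (1 ℕ.+ a₀)) f))
    (separated-by (here refl) (β₋₂∉basic ((2 ℕ.+ a₀) ℕ.+ (1 ℕ.+ a₀)) f))
    (∈-separates (here refl) (β∉∷ (λ ()) (β₋₁∉basic 0 (2 ℕ.+ f))))

  ¬two-v₋₁≡2-e≡2v₀-2-f≡v₁-2 : a₋₁ ≡ 0 → ¬ PartitionCount D (α ((2 ℕ.+ a₀) ℕ.+ a₀) a₁) 2
  ¬two-v₋₁≡2-e≡2v₀-2-f≡v₁-2 a₋₁≡0 = three⇒¬partitionCount-2 _ _ _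
    (basicPartition-rep (suc a₀ ℕ.+ a₀) a₁)
    (carry-left-rep {a₀} {a₁} (basicPartition-rep₁ a₀ a₁))
    (subst (λ γ → IndecRep D γ (β -[1+ 1 ] ∷ β (+ 2) ∷ [])) (sym (split-β₋₂-β₂ a₋₁≡0))
      (∷-rep -[1+ 1 ] (indecomposable (+ 2) ∷ []) (⊕-identityʳ (β (+ 2)))))
    (separated-by (here refl) (β₋₁∉basic ((2 ℕ.+ a₀) ℕ.+ a₀) a₁))
    (separated-by (here refl) (β₋₂∉basic ((2 ℕ.+ a₀) ℕ.+ a₀) a₁))
    (∈-separates (here refl) (β∉∷ (λ ()) (β∉∷ (λ ()) λ ())))

  ¬two-all-v≡2 : a₋₁ ≡ 0 → a₀ ≡ 0 → a₁ ≡ 0 → a₂ ≡ 0 → ¬ PartitionCount D (α 1 1) 2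
  ¬two-all-v≡2 a₋₁≡0 a₀≡0 a₁≡0 a₂≡0 = three⇒¬partitionCount-2 _ _ _
    (basicPartition-rep 0 1)
    (subst₂ (λ e f → IndecRep D (α (suc e) (suc f)) (β -1ℤ ∷ β (+ 2) ∷ [])) a₀≡0 a₁≡0 corner-rep)
    (subst (λ γ → IndecRep D γ (β -[1+ 1 ] ∷ β (+ 3) ∷ [])) (sym (split-β₋₂-β₃ a₋₁≡0 a₀≡0 a₁≡0 a₂≡0))
      (∷-rep -[1+ 1 ] (indecomposable (+ 3) ∷ []) (⊕-identityʳ (β (+ 3)))))
    (separated-by (here refl) (β₋₁∉basic 1 1))
    (separated-by (here refl) (β₋₂∉basic 1 1))
    (∈-separates (here refl) (β∉∷ (λ ()) (β∉∷ (λ ()) λ ())))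

  two⇒Strip : ∀ {e′ f} → e′ ℕ.≤ 1 ℕ.+ a₀ → f ℕ.≤ a₁ → PartitionCount D (α (2 ℕ.+ a₀ ℕ.+ e′) f) 2
            → Strip a₋₁ a₀ a₁ (2 ℕ.+ a₀ ℕ.+ e′) f
  two⇒Strip {e′} {f} e′≤ f≤ two = ℕP.m≤m+n (2 ℕ.+ a₀) e′ , ℕP.+-monoʳ-≤ (2 ℕ.+ a₀) e′≤ , f≤
    , (λ (e≡ , f≡) → ¬two-e≡2v₀-1-f≡v₁-2 (subst₂ (λ x y → PartitionCount D (α x y) 2) e≡ f≡ two))
    , (λ (a₋₁≡0 , e≡) → ¬two-v₋₁≡2-e≡2v₀-1 a₋₁≡0 f (subst (λ x → PartitionCount D (α x f) 2) e≡ two))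
    , (λ (a₋₁≡0 , e≡ , f≡) → ¬two-v₋₁≡2-e≡2v₀-2-f≡v₁-2 a₋₁≡0 (subst₂ (λ x y → PartitionCount D (α x y) 2) e≡ f≡ two))

  two⇒Corner : PartitionCount D (α (1 ℕ.+ a₀) (1 ℕ.+ a₁)) 2 → Corner a₋₁ a₀ a₁ a₂ (1 ℕ.+ a₀) (1 ℕ.+ a₁)
  two⇒Corner two = refl , refl , λ (a₋₁≡0 , a₀≡0 , a₁≡0 , a₂≡0) →
    ¬two-all-v≡2 a₋₁≡0 a₀≡0 a₁≡0 a₂≡0 (subst₂ (λ x y → PartitionCount D (α (suc x) (suc y)) 2) a₀≡0 a₁≡0 two)

-- The three regions of the theorem

module Classification {D : ℕ} (C : Chain D) where

  open Partitions C public
  private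
    module Mirror = Partitions (reflect C)

  Regions : ℕ → ℕ → Set
  Regions e f = Strip a₋₁ a₀ a₁ e f ⊎ (1 ℕ.≤ e × Strip a₂ a₁ a₀ f e) ⊎ Corner a₋₁ a₀ a₁ a₂ e f

  private
    PC₂ : OK → Set
    PC₂ γ = PartitionCount D γ 2

    mirror-two : ∀ {e f} → PC₂ (α e f) → PC₂ (Mirror.α f e)
    mirror-two {e} {f} = subst PC₂ (sym (mirror-α e f))

    unmirror-two : ∀ {e f} → PC₂ (Mirror.α f e) → PC₂ (α e f)
    unmirror-two {e} {f} = subst PC₂ (mirror-α e f)

  regions⇒two : ∀ {e f} → Regions e f → PC₂ (α e f)
  regions⇒two (inj₁ strip) = Strip⇒two strip
  regions⇒two {e} {f} (inj₂ (inj₁ (_ , strip))) = unmirror-two {e} {f} (Mirror.Strip⇒two {f} {e} strip)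
  regions⇒two (inj₂ (inj₂ corner)) = Corner⇒two corner

  BelowCorner-low : ∀ {e f} → e ℕ.≤ a₀ → f ℕ.≤ 1 ℕ.+ a₁ → BelowCorner a₀ a₁ e f
  BelowCorner-low e≤ f≤ = ℕP.m≤n⇒m≤1+n e≤ , f≤ , λ (e≡ , _) → ℕP.<-irrefl e≡ (s≤s e≤)

  two⇒regions : ∀ {e f} → 1 ℕ.≤ e → PC₂ (α e f) → Regions e f
  two⇒regions {e} {f} 1≤e two with mirror-two {e} {f} two | zone a₀ e | zone a₁ f
  ... | _     | high e″       | _             = ⊥-elim (¬two-2v₀≤e e″ f two)
  ... | two′  | _             | high f″       = ⊥-elim (Mirror.¬two-2v₀≤e f″ e two′)
  ... | _     | middle e′ _   | middle f′ _   = ⊥-elim (¬two-v₀≤e-v₁≤f e′ f′ two)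
  ... | _     | middle e′ _   | edge          = ⊥-elim (¬two-v₀≤e-f≡v₁-1 e′ two)
  ... | two′  | edge          | middle f′ _   = ⊥-elim (Mirror.¬two-v₀≤e-f≡v₁-1 f′ two′)
  ... | _     | middle e′ e′≤ | low f≤        = inj₁ (two⇒Strip e′≤ f≤ two)
  ... | two′  | low e≤        | middle f′ f′≤ = inj₂ (inj₁ (1≤e , Mirror.two⇒Strip f′≤ e≤ two′))
  ... | _     | edge          | edge          = inj₂ (inj₂ (two⇒Corner two))
  ... | _     | low e≤        | low f≤        = ⊥-elim (BelowCorner⇒¬two (BelowCorner-low e≤ (ℕP.m≤n⇒m≤1+n f≤)) two)
  ... | _     | low e≤        | edge          = ⊥-elim (BelowCorner⇒¬two (BelowCorner-low e≤ ℕP.≤-refl) two)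
  ... | _     | edge          | low f≤        = ⊥-elim (BelowCorner⇒¬two (ℕP.≤-refl , ℕP.m≤n⇒m≤1+n f≤
                                                  , λ (_ , f≡) → ℕP.<-irrefl f≡ (s≤s f≤)) two)

  two⇔regions : ∀ {e f} → 1 ℕ.≤ e → PC₂ (α e f) ⇔ Regions e f
  two⇔regions 1≤e = mk⇔ (two⇒regions 1≤e) regions⇒two

private
  ≤⇔ : ∀ {x y m n} → x ≡ + m → y ≡ + n → (x ≤ y) ⇔ (m ℕ.≤ n)
  ≤⇔ x≡ y≡ = mk⇔ (λ x≤y → ℤP.drop‿+≤+ (subst₂ _≤_ x≡ y≡ x≤y)) (λ m≤n → subst₂ _≤_ (sym x≡) (sym y≡) (+≤+ m≤n))

  ≡⇔ : ∀ {x y m n} → x ≡ + m → y ≡ + n → (x ≡ y) ⇔ (m ≡ n)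
  ≡⇔ x≡ y≡ = mk⇔ (λ x≡y → ℤP.+-injective (trans (sym x≡) (trans x≡y y≡)))
                  (λ m≡n → trans x≡ (trans (cong +_ m≡n) (sym y≡)))

  ≡2⇔ : ∀ {x a} → x ≡ + (2 ℕ.+ a) → (x ≡ + 2) ⇔ (a ≡ 0)
  ≡2⇔ x≡ = ⇔-trans (≡⇔ x≡ refl) (mk⇔ (ℕP.+-cancelˡ-≡ 2 _ _) (cong (2 ℕ.+_)))

  ,≡⇔ : ∀ {A B : Set} {a c : A} {b d : B} → ((a , b) ≡ (c , d)) ⇔ (a ≡ c × b ≡ d)
  ,≡⇔ = mk⇔ (λ eq → ,-injectiveˡ eq , ,-injectiveʳ eq) (λ (a≡c , b≡d) → cong₂ _,_ a≡c b≡d)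

  ×-swap⇔ : ∀ {A B : Set} → (A × B) ⇔ (B × A)
  ×-swap⇔ = mk⇔ Product.swap Product.swap

  ×-reverse⇔ : ∀ {A B C : Set} → (A × B × C) ⇔ (C × B × A)
  ×-reverse⇔ = mk⇔ (λ (x , y , z) → z , y , x) (λ (z , y , x) → x , y , z)

  drop-true : ∀ {A B : Set} → A → (A × B) ⇔ B
  drop-true a = mk⇔ proj₂ (a ,_)

  2v-1≡ : ∀ {x a} → x ≡ + (2 ℕ.+ a) → + 2 * x - 1ℤ ≡ + ((2 ℕ.+ a) ℕ.+ (1 ℕ.+ a))
  2v-1≡ {a = a} refl = identity (+ a)
    where
    identity : ∀ A → + 2 * (+ 2 + A) - 1ℤ ≡ + 2 + A + (1ℤ + A)
    identity = solve-∀

  2v-2≡ : ∀ {x a} → x ≡ + (2 ℕ.+ a) → + 2 * x - + 2 ≡ + ((2 ℕ.+ a) ℕ.+ a)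
  2v-2≡ {a = a} refl = identity (+ a)
    where
    identity : ∀ A → + 2 * (+ 2 + A) - + 2 ≡ + 2 + A + A
    identity = solve-∀

  v-1≡ : ∀ {x a} → x ≡ + (2 ℕ.+ a) → x - 1ℤ ≡ + (1 ℕ.+ a)
  v-1≡ refl = refl

  v-2≡ : ∀ {x a} → x ≡ + (2 ℕ.+ a) → x - + 2 ≡ + a
  v-2≡ refl = refl

module Conditions {v : ℤ → ℤ} {j : ℤ} {a₋₁ a₀ a₁ a₂ : ℕ}
                  (v₋₁≡ : v (j - 1ℤ) ≡ + (2 ℕ.+ a₋₁)) (v₀≡ : v j ≡ + (2 ℕ.+ a₀))
                  (v₁≡ : v (j + 1ℤ) ≡ + (2 ℕ.+ a₁)) (v₂≡ : v (j + + 2) ≡ + (2 ℕ.+ a₂)) (e f : ℕ) where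

  Cond1⇔Strip : Cond1 v j (+ e) (+ f) ⇔ Strip a₋₁ a₀ a₁ e f
  Cond1⇔Strip =
    ≤⇔ v₀≡ refl ×-⇔ ≤⇔ refl (2v-1≡ v₀≡) ×-⇔ ⇔-trans (drop-true (+≤+ z≤n)) (≤⇔ refl (v-2≡ v₁≡)
    ×-⇔ ¬-cong-⇔ (⇔-trans ,≡⇔ (≡⇔ refl (2v-1≡ v₀≡) ×-⇔ ≡⇔ refl (v-2≡ v₁≡)))
    ×-⇔ ¬-cong-⇔ (⇔-trans ,≡⇔ (≡2⇔ v₋₁≡ ×-⇔ ≡⇔ refl (2v-1≡ v₀≡)))
    ×-⇔ ¬-cong-⇔ (⇔-trans ,≡⇔ (≡2⇔ v₋₁≡ ×-⇔ ⇔-trans ,≡⇔ (≡⇔ refl (2v-2≡ v₀≡) ×-⇔ ≡⇔ refl (v-2≡ v₁≡)))))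

  Cond2⇔Strip-mirror : Cond2 v j (+ e) (+ f) ⇔ (1 ℕ.≤ e × Strip a₂ a₁ a₀ f e)
  Cond2⇔Strip-mirror = ≤⇔ refl refl ×-⇔ ⇔-trans reorder
    (≤⇔ v₁≡ refl ×-⇔ ≤⇔ refl (2v-1≡ v₁≡) ×-⇔ ≤⇔ refl (v-2≡ v₀≡)
    ×-⇔ ¬-cong-⇔ (⇔-trans ,≡⇔ (⇔-trans (≡⇔ refl (v-2≡ v₀≡) ×-⇔ ≡⇔ refl (2v-1≡ v₁≡)) ×-swap⇔))
    ×-⇔ ¬-cong-⇔ (⇔-trans ,≡⇔ (⇔-trans (≡⇔ refl (2v-1≡ v₁≡) ×-⇔ ≡2⇔ v₂≡) ×-swap⇔))
    ×-⇔ ¬-cong-⇔ (⇔-trans ,≡⇔ (⇔-trans (≡⇔ refl (v-2≡ v₀≡) ×-⇔ ⇔-trans ,≡⇔ (≡⇔ refl (2v-2≡ v₁≡) ×-⇔ ≡2⇔ v₂≡))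
                   ×-reverse⇔)))
    where
    reorder : ∀ {A B C R : Set} → (A × B × C × R) ⇔ (B × C × A × R)
    reorder = mk⇔ (λ (x , y , z , r) → y , z , x , r) (λ (y , z , x , r) → x , y , z , r)

  Cond3⇔Corner : Cond3 v j (+ e) (+ f) ⇔ Corner a₋₁ a₀ a₁ a₂ e f
  Cond3⇔Corner = ≡⇔ refl (v-1≡ v₀≡) ×-⇔ ≡⇔ refl (v-1≡ v₁≡)
    ×-⇔ ¬-cong-⇔ (⇔-trans ,≡⇔ (≡2⇔ v₋₁≡ ×-⇔ ⇔-trans ,≡⇔ (≡2⇔ v₀≡ ×-⇔ ⇔-trans ,≡⇔ (≡2⇔ v₁≡ ×-⇔ ≡2⇔ v₂≡))))

theorem6p1 : (D : ℕ) → 2 ℕ.≤ D → SquareFree D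
    → (β : ℤ → OK) → IsIndecSequence D β
    → (v : ℤ → ℤ) → IsVSequence β v
    → (α : OK) → (j e f : ℤ) → 1ℤ ≤ e → 0ℤ ≤ f
    → α ≡ (e · β j) ⊕ (f · β (j + 1ℤ))
    → PartitionCount D α 2 ⇔ (Cond1 v j e f ⊎ Cond2 v j e f ⊎ Cond3 v j e f)
theorem6p1 D _ _ β β-seq v v-seq α j e f 1≤e 0≤f α≡ = begin
  PartitionCount D α 2                    ≡⟨ cong (λ γ → PartitionCount D γ 2) α≡αₙ ⟩
  PartitionCount D (C.α ∣ e ∣ ∣ f ∣) 2    ≈⟨ C.two⇔regions 1≤∣e∣ ⟩
  C.Regions ∣ e ∣ ∣ f ∣                   ≈⟨ Cond1⇔Strip ⊎-⇔ Cond2⇔Strip-mirror ⊎-⇔ Cond3⇔Corner ⟨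
  Conds (+ ∣ e ∣) (+ ∣ f ∣)               ≡⟨ cong₂ Conds e≡ f≡ ⟩
  Conds e f                               ∎
  where
  open FromHypotheses {D} {β} {v} β-seq v-seq
  module C = Classification (chainAt j)
  open Relation.Binary.Reasoning.Setoid (⇔-setoid 0ℓ)
  Conds : ℤ → ℤ → Set
  Conds x y = Cond1 v j x y ⊎ Cond2 v j x y ⊎ Cond3 v j x y
  e≡ : + ∣ e ∣ ≡ e
  e≡ = ℤP.0≤i⇒+∣i∣≡i (ℤP.≤-trans (+≤+ z≤n) 1≤e)
  f≡ : + ∣ f ∣ ≡ f
  f≡ = ℤP.0≤i⇒+∣i∣≡i 0≤f
  1≤∣e∣ : 1 ℕ.≤ ∣ e ∣
  1≤∣e∣ = ℤP.drop‿+≤+ (subst (1ℤ ≤_) (sym e≡) 1≤e)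
  α≡αₙ : α ≡ C.α ∣ e ∣ ∣ f ∣
  α≡αₙ = trans α≡ (cong₂ _⊕_ (cong₂ _·_ (sym e≡) (cong β (sym (ℤP.+-identityʳ j)))) (cong (_· β (j + 1ℤ)) (sym f≡)))
  open Conditions {v} {j} (v-chainAt j -1ℤ) (trans (cong v (sym (ℤP.+-identityʳ j))) (v-chainAt j 0ℤ))
                  (v-chainAt j 1ℤ) (v-chainAt j (+ 2)) ∣ e ∣ ∣ f ∣
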